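{- Let $\epsilon\in(0,1)$ and $\delta\in(0,\frac16)$ be reals, and let $h\ge 6/\epsilon$ and $1\le p\le 2^{h(1-\epsilon)}$ be integers. Let $\mathcal{Z}$ be a set, $f:\{0,1\}^p\to\mathcal{Z}$ a function, and $g:\mathcal{A}\times\mathcal{B}\to\{0,1\}$ a (possibly partial) function on finite sets $\mathcal{A},\mathcal{B}$. If $g$ has $(\delta,h)$-hitting monochromatic rectangle-distributions, then $$\mathcal{D}^{dt}(f)\le \frac{4}{\epsilon\cdot h}\cdot\mathcal{D}^{cc}(f\circ g^p).$$
   Context: A rectangle $U\times V\subseteq\mathcal{A}\times\mathcal{B}$ is $c$-monochromatic if $g(u,v)$ is defined and equals $c$ for all $(u,v)\in U\times V$. A distribution $\sigma$ over rectangles in $\mathcal{A}\times\mathcal{B}$ is a $(\delta,h)$-hitting rectangle-distribution if for all $X\subseteq\mathcal{A}$, $Y\subseteq\mathcal{B}$ with $|X|/|\mathcal{A}|\ge 2^{ -h}$ and $|Y|/|\mathcal{B}|\ge2^{ -h}$, $\Pr_{R\sim\sigma}[R\cap(X\times Y)\neq\emptyset]\ge1-\delta$. $g$ has $(\delta,h)$-hitting monochromatic rectangle-distributions if there exist $(\delta,h)$-hitting rectangle-distributions $\sigma_0,\sigma_1$ with $\sigma_c$ supported on $c$-monochromatic rectangles. $f\circ g^p:\mathcal{A}^p\times\mathcal{B}^p\to\mathcal{Z}$ is $(x,y)\mapsto f(g(x_1,y_1),\dots,g(x_p,y_p))$, defined when all $g(x_i,y_i)$ are defined. $\mathcal{D}^{cc}(F)$: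 minimum depth of a deterministic two-party protocol (Alice gets $x$, Bob gets $y$) correct on the whole domain of $F$. $\mathcal{D}^{dt}(f)$: minimum depth of a deterministic decision tree computing $f$ by querying bits of its input.
   Formalization: The parameters ε and δ and the probabilities of the hitting rectangle-distributions are rational rather than real. -}

module Defs where

open import Data.Bool using (Bool; true; false; _∧_; if_then_else_)
open import Data.Nat as ℕ using (ℕ; zero; suc; _<ᵇ_; _⊔_)
open import Data.Fin using (Fin)
open import Data.Fin.Subset using (Subset; _∈_; _∩_; ∣_∣)
open import Data.Maybe using (Maybe; just; nothing)
open import Data.Vec using (Vec; []; _∷_; lookup)
open import Data.List using (List; []; _∷_)
open import Data.Product using (_×_; _,_)
open import Data.Rational using (ℚ; 0ℚ; 1ℚ; _+_; _-_; _≤_)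
open import Relation.Binary.PropositionalEquality using (_≡_)

Rectangle : ℕ → ℕ → Set
Rectangle na nb = Subset na × Subset nb

PartialFun : ℕ → ℕ → Set
PartialFun na nb = Fin na → Fin nb → Maybe Bool

Monochromatic : ∀ {na nb} → PartialFun na nb → Bool → Rectangle na nb → Set
Monochromatic g c (U , V) = ∀ u v → u ∈ U → v ∈ V → g u v ≡ just c

-- A (finitely supported) distribution over rectangles: a list of
-- (probability, rectangle) pairs, nonnegative weights summing to 1.
RectDist : ℕ → ℕ → Set
RectDist na nb = List (ℚ × Rectangle na nb)

totalWeight : ∀ {na nb} → RectDist na nb → ℚ
totalWeight [] = 0ℚ
totalWeight ((w , _) ∷ σ) = w + totalWeight σ

data AllNonneg {na nb : ℕ} : RectDist na nb → Set where
  []  : AllNonneg []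
  _∷_ : ∀ {w R σ} → 0ℚ ≤ w → AllNonneg σ → AllNonneg ((w , R) ∷ σ)

IsDistribution : ∀ {na nb} → RectDist na nb → Set
IsDistribution σ = AllNonneg σ × totalWeight σ ≡ 1ℚ

data SupportedOn {na nb : ℕ} (P : Rectangle na nb → Set) : RectDist na nb → Set where
  []  : SupportedOn P []
  _∷_ : ∀ {w R σ} → P R → SupportedOn P σ → SupportedOn P ((w , R) ∷ σ)

intersects : ∀ {na nb} → Rectangle na nb → Subset na → Subset nb → Bool
intersects (U , V) X Y = (0 <ᵇ ∣ U ∩ X ∣) ∧ (0 <ᵇ ∣ V ∩ Y ∣)

probHit : ∀ {na nb} → RectDist na nb → Subset na → Subset nb → ℚ
probHit [] X Y = 0ℚ
probHit ((w , R) ∷ σ) X Y =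
  (if intersects R X Y then w else 0ℚ) + probHit σ X Y

-- (δ,h)-hitting rectangle-distribution.  The density condition
-- |X|/|A| ≥ 2^{-h} is written as |A| ≤ 2^h · |X|.
IsHitting : ∀ {na nb} → ℚ → ℕ → RectDist na nb → Set
IsHitting {na} {nb} δ h σ =
  IsDistribution σ ×
  (∀ (X : Subset na) (Y : Subset nb) →
     na ℕ.≤ 2 ℕ.^ h ℕ.* ∣ X ∣ → nb ℕ.≤ 2 ℕ.^ h ℕ.* ∣ Y ∣ →
     1ℚ - δ ≤ probHit σ X Y)

HasHittingMonoDists : ∀ {na nb} → PartialFun na nb → ℚ → ℕ → Set
HasHittingMonoDists g δ h =
  (Data.Product.Σ (RectDist _ _) λ σ₀ → IsHitting δ h σ₀ × SupportedOn (Monochromatic g false) σ₀) ×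
  (Data.Product.Σ (RectDist _ _) λ σ₁ → IsHitting δ h σ₁ × SupportedOn (Monochromatic g true) σ₁)

gPow : ∀ {na nb p} → PartialFun na nb → Vec (Fin na) p → Vec (Fin nb) p → Maybe (Vec Bool p)
gPow g [] [] = just []
gPow g (x ∷ xs) (y ∷ ys) with g x y | gPow g xs ys
... | just b | just bs = just (b ∷ bs)
... | _      | _       = nothing

compose : ∀ {na nb p} {Z : Set} → (Vec Bool p → Z) → PartialFun na nb →
          Vec (Fin na) p → Vec (Fin nb) p → Maybe Z
compose f g x y with gPow g x y
... | just b  = just (f b)
... | nothing = nothing

data Protocol (X Y Z : Set) : Set where
  output : Z → Protocol X Y Z
  alice  : (X → Bool) → (onFalse onTrue : Protocol X Y Z) → Protocol X Y Z
  bob    : (Y → Bool) → (onFalse onTrue : Protocol X Y Z) → Protocol X Y Z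

runP : ∀ {X Y Z} → Protocol X Y Z → X → Y → Z
runP (output z) x y = z
runP (alice m P₀ P₁) x y = if m x then runP P₁ x y else runP P₀ x y
runP (bob m P₀ P₁) x y = if m y then runP P₁ x y else runP P₀ x y

depthP : ∀ {X Y Z} → Protocol X Y Z → ℕ
depthP (output _) = 0
depthP (alice _ P₀ P₁) = suc (depthP P₀ ⊔ depthP P₁)
depthP (bob _ P₀ P₁) = suc (depthP P₀ ⊔ depthP P₁)

ProtocolComputes : ∀ {X Y Z} → Protocol X Y Z → (X → Y → Maybe Z) → Set
ProtocolComputes P F = ∀ x y z → F x y ≡ just z → runP P x y ≡ z

data DecTree (p : ℕ) (Z : Set) : Set where
  leaf  : Z → DecTree p Z
  query : Fin p → (onFalse onTrue : DecTree p Z) → DecTree p Z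

evalT : ∀ {p Z} → DecTree p Z → Vec Bool p → Z
evalT (leaf z) w = z
evalT (query i T₀ T₁) w = if lookup w i then evalT T₁ w else evalT T₀ w

depthT : ∀ {p Z} → DecTree p Z → ℕ
depthT (leaf _) = 0
depthT (query _ T₀ T₁) = suc (depthT T₀ ⊔ depthT T₁)

TreeComputes : ∀ {p Z} → DecTree p Z → (Vec Bool p → Z) → Set
TreeComputes T f = ∀ w → evalT T w ≡ f w

{-# OPTIONS --safe #-}
module Submission where

-- The decision tree follows the protocol on a rectangle S × T ⊆ Aᵖ × Bᵖ of inputs to f ∘ gᵖ
-- that is thick in every unqueried coordinate: along it, every point has a fibre of density at
-- least 2⁻ʰ. Thickness and the hitting distributions realise every value of the unqueried bits
-- inside S × T, so at a leaf of the protocol its output is f of the queried bits. When a player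
-- speaks, the tree keeps the larger half of that player's set and re-thickens it, losing a
-- factor 3 as long as no free cylinder of the set is 2ʰ/(6p) times larger than the set;
-- otherwise it queries that coordinate j and restricts both sets through a monochromatic
-- rectangle of colour w_j that meets most fibres, which multiplies |S|·|T| by at least
-- 2ʰ/(9p). Since |S|·|T| ≤ |A|ᵖ|B|ᵖ, a path with c bits and q queries has
-- 2^(hq) ≤ 3^c (9p)^q, which together with p^ε ≤ 2^(h(1-ε)) and h ≥ 6/ε gives q ≤ 4c/(εh).

open import Data.Bool using (Bool)
open import Data.Nat using (ℕ)
open import Data.Fin using (Fin)

module Sums where

  open import Data.Bool using (Bool; true; false; if_then_else_)
  open import Data.Nat using (ℕ; zero; suc; _+_; _*_; _^_; _≤_; z≤n)
  open import Data.Nat.Properties hiding (_≟_)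
  open import Data.Fin using (Fin; zero; suc; _≟_)
  open import Data.Vec using (Vec; []; _∷_)
  open import Relation.Nullary using (does)
  open import Relation.Binary.PropositionalEquality
  import Data.Nat.Tactic.RingSolver as Ring

  𝟙 : Bool → ℕ
  𝟙 true = 1
  𝟙 false = 0

  𝟙-mono : ∀ {a b} → (a ≡ true → b ≡ true) → 𝟙 a ≤ 𝟙 b
  𝟙-mono {false} _ = z≤n
  𝟙-mono {true} a⇒b rewrite a⇒b refl = ≤-refl

  ∑ : ∀ n → (Fin n → ℕ) → ℕ
  ∑ zero f = 0
  ∑ (suc n) f = f zero + ∑ n (λ a → f (suc a))

  ∑-cong : ∀ n {f g : Fin n → ℕ} → (∀ a → f a ≡ g a) → ∑ n f ≡ ∑ n g
  ∑-cong zero f≗g = refl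
  ∑-cong (suc n) f≗g = cong₂ _+_ (f≗g zero) (∑-cong n (λ a → f≗g (suc a)))

  ∑-mono-≤ : ∀ n {f g : Fin n → ℕ} → (∀ a → f a ≤ g a) → ∑ n f ≤ ∑ n g
  ∑-mono-≤ zero f≤g = z≤n
  ∑-mono-≤ (suc n) f≤g = +-mono-≤ (f≤g zero) (∑-mono-≤ n (λ a → f≤g (suc a)))

  ∑-distrib-+ : ∀ n (f g : Fin n → ℕ) → ∑ n (λ a → f a + g a) ≡ ∑ n f + ∑ n g
  ∑-distrib-+ zero f g = refl
  ∑-distrib-+ (suc n) f g = begin
    f zero + g zero + ∑ n (λ a → f (suc a) + g (suc a))
      ≡⟨ cong (f zero + g zero +_) (∑-distrib-+ n _ _) ⟩
    f zero + g zero + (∑ n (λ a → f (suc a)) + ∑ n (λ a → g (suc a)))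
      ≡⟨ +-interchange (f zero) (g zero) _ _ ⟩
    f zero + ∑ n (λ a → f (suc a)) + (g zero + ∑ n (λ a → g (suc a))) ∎
    where
    open ≡-Reasoning
    +-interchange : ∀ a b c d → a + b + (c + d) ≡ a + c + (b + d)
    +-interchange = Ring.solve-∀

  ∑-const : ∀ n k → ∑ n (λ _ → k) ≡ n * k
  ∑-const zero k = refl
  ∑-const (suc n) k = cong (k +_) (∑-const n k)

  ∑-*ˡ : ∀ n k (f : Fin n → ℕ) → ∑ n (λ a → k * f a) ≡ k * ∑ n f
  ∑-*ˡ zero k f = sym (*-zeroʳ k)
  ∑-*ˡ (suc n) k f = trans (cong (k * f zero +_) (∑-*ˡ n k _)) (sym (*-distribˡ-+ k (f zero) _))

  ∑-term-≤ : ∀ n (f : Fin n → ℕ) a → f a ≤ ∑ n f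
  ∑-term-≤ (suc n) f zero = m≤m+n _ _
  ∑-term-≤ (suc n) f (suc a) = ≤-trans (∑-term-≤ n _ a) (m≤n+m _ _)

  ∑-mono-≤-gap : ∀ n {f g : Fin n → ℕ} k (j : Fin n) → (∀ a → f a ≤ g a) → f j + k ≤ g j →
                 ∑ n f + k ≤ ∑ n g
  ∑-mono-≤-gap (suc n) {f} {g} k zero f≤g gap = begin
    f zero + ∑ n _ + k   ≡⟨ +-assoc (f zero) _ k ⟩
    f zero + (∑ n _ + k) ≡⟨ cong (f zero +_) (+-comm _ k) ⟩
    f zero + (k + ∑ n _) ≡⟨ +-assoc (f zero) k _ ⟨
    f zero + k + ∑ n _   ≤⟨ +-mono-≤ gap (∑-mono-≤ n (λ a → f≤g (suc a))) ⟩
    g zero + ∑ n _       ∎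
    where open ≤-Reasoning
  ∑-mono-≤-gap (suc n) {f} {g} k (suc j) f≤g gap = begin
    f zero + ∑ n _ + k   ≡⟨ +-assoc (f zero) _ k ⟩
    f zero + (∑ n _ + k) ≤⟨ +-mono-≤ (f≤g zero) (∑-mono-≤-gap n k j (λ a → f≤g (suc a)) gap) ⟩
    g zero + ∑ n _       ∎
    where open ≤-Reasoning

  ∑-at : ∀ n (x : Fin n) (G : Fin n → ℕ) → ∑ n (λ a → if does (x ≟ a) then G a else 0) ≡ G x
  ∑-at (suc n) zero G = trans (cong (G zero +_) (∑-const n 0)) (trans (cong (G zero +_) (*-zeroʳ n)) (+-identityʳ _))
  ∑-at (suc n) (suc x) G = ∑-at n x (λ a → G (suc a))

  ∑ᶜ : ∀ {n} p → (Vec (Fin n) p → ℕ) → ℕ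
  ∑ᶜ zero f = f []
  ∑ᶜ {n} (suc p) f = ∑ n (λ a → ∑ᶜ p (λ x → f (a ∷ x)))

  ∑ᶜ-cong : ∀ {n} p {f g : Vec (Fin n) p → ℕ} → (∀ x → f x ≡ g x) → ∑ᶜ p f ≡ ∑ᶜ p g
  ∑ᶜ-cong zero f≗g = f≗g []
  ∑ᶜ-cong {n} (suc p) f≗g = ∑-cong n (λ a → ∑ᶜ-cong p (λ x → f≗g (a ∷ x)))

  ∑ᶜ-mono-≤ : ∀ {n} p {f g : Vec (Fin n) p → ℕ} → (∀ x → f x ≤ g x) → ∑ᶜ p f ≤ ∑ᶜ p g
  ∑ᶜ-mono-≤ zero f≤g = f≤g []
  ∑ᶜ-mono-≤ {n} (suc p) f≤g = ∑-mono-≤ n (λ a → ∑ᶜ-mono-≤ p (λ x → f≤g (a ∷ x)))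

  ∑ᶜ-distrib-+ : ∀ {n} p (f g : Vec (Fin n) p → ℕ) → ∑ᶜ p (λ x → f x + g x) ≡ ∑ᶜ p f + ∑ᶜ p g
  ∑ᶜ-distrib-+ zero f g = refl
  ∑ᶜ-distrib-+ {n} (suc p) f g = trans (∑-cong n (λ a → ∑ᶜ-distrib-+ p _ _)) (∑-distrib-+ n _ _)

  ∑ᶜ-const : ∀ {n} p k → ∑ᶜ {n} p (λ _ → k) ≡ n ^ p * k
  ∑ᶜ-const zero k = sym (+-identityʳ k)
  ∑ᶜ-const {n} (suc p) k = begin
    ∑ n (λ a → ∑ᶜ p (λ _ → k)) ≡⟨ ∑-cong n (λ a → ∑ᶜ-const p k) ⟩
    ∑ n (λ a → n ^ p * k)      ≡⟨ ∑-const n _ ⟩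
    n * (n ^ p * k)            ≡⟨ *-assoc n _ k ⟨
    n * n ^ p * k              ∎
    where open ≡-Reasoning

  ∑ᶜ-zero : ∀ {n} p → ∑ᶜ {n} p (λ _ → 0) ≡ 0
  ∑ᶜ-zero {n} p = trans (∑ᶜ-const p 0) (*-zeroʳ (n ^ p))

module Search where

  open import Data.Bool using (Bool; true; false; _∧_; _∨_)
  open import Data.Nat using (zero; suc)
  open import Data.Fin using (Fin; zero; suc)
  open import Data.Fin.Properties using (any?)
  open import Data.Vec using (Vec; []; _∷_)
  open import Data.Product using (Σ; ∃; _,_)
  open import Relation.Nullary using (Dec; map′)
  open import Relation.Binary.PropositionalEquality

  anyᵇ : ∀ n → (Fin n → Bool) → Bool
  anyᵇ zero P = false
  anyᵇ (suc n) P = P zero ∨ anyᵇ n (λ a → P (suc a))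

  anyᵇ⁺ : ∀ n (P : Fin n → Bool) a → P a ≡ true → anyᵇ n P ≡ true
  anyᵇ⁺ (suc n) P zero Pa rewrite Pa = refl
  anyᵇ⁺ (suc n) P (suc a) Pa with P zero
  ... | true = refl
  ... | false = anyᵇ⁺ n (λ a → P (suc a)) a Pa

  anyᵇ⁻ : ∀ n (P : Fin n → Bool) → anyᵇ n P ≡ true → Σ (Fin n) λ a → P a ≡ true
  anyᵇ⁻ (suc n) P any with P zero in P0
  ... | true = zero , P0
  ... | false = let (a , Pa) = anyᵇ⁻ n (λ a → P (suc a)) any in suc a , Pa

  anyᵇ-none : ∀ n (P : Fin n → Bool) → (∀ a → P a ≡ false) → anyᵇ n P ≡ false
  anyᵇ-none zero P none = refl
  anyᵇ-none (suc n) P none rewrite none zero = anyᵇ-none n _ (λ a → none (suc a))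

  anyᵇ-cong : ∀ n {P Q : Fin n → Bool} → (∀ a → P a ≡ Q a) → anyᵇ n P ≡ anyᵇ n Q
  anyᵇ-cong zero P≗Q = refl
  anyᵇ-cong (suc n) P≗Q = cong₂ _∨_ (P≗Q zero) (anyᵇ-cong n (λ a → P≗Q (suc a)))

  anyᶜ? : ∀ {n} p {P : Vec (Fin n) p → Set} → (∀ x → Dec (P x)) → Dec (∃ P)
  anyᶜ? zero P? = map′ ([] ,_) (λ { ([] , P[]) → P[] }) (P? [])
  anyᶜ? (suc p) P? = map′ (λ (a , x , Pax) → a ∷ x , Pax) (λ { (a ∷ x , Pax) → a , x , Pax })
                          (any? λ a → anyᶜ? p (λ x → P? (a ∷ x)))

  ∧-true₁ : ∀ {a b} → a ∧ b ≡ true → a ≡ true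
  ∧-true₁ {true} _ = refl

  ∧-true₂ : ∀ {a b} → a ∧ b ≡ true → b ≡ true
  ∧-true₂ {true} b≡true = b≡true

module Lines where

  open import Data.Bool using (Bool; true; false; _∧_; not; if_then_else_)
  open import Data.Nat using (ℕ; zero; suc)
  open import Data.Fin using (Fin; zero; suc; _≟_)
  open import Data.Vec using (Vec; []; _∷_; lookup; _[_]≔_)
  open import Data.Vec.Properties using (≡-dec)
  open import Relation.Nullary using (does; yes; no)
  open import Data.Product using (_×_; _,_)
  open import Relation.Binary.PropositionalEquality
  open Sums

  onLine : ∀ {n p} → Fin p → Vec (Fin n) p → Vec (Fin n) p → Bool
  onLine zero (_ ∷ x) (_ ∷ y) = does (≡-dec _≟_ x y)
  onLine (suc j) (a ∷ x) (b ∷ y) = does (a ≟ b) ∧ onLine j x y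

  onLine-[]≔ : ∀ {n p} j (x y : Vec (Fin n) p) a → onLine j x (y [ j ]≔ a) ≡ onLine j x y
  onLine-[]≔ zero (_ ∷ x) (_ ∷ y) a = refl
  onLine-[]≔ (suc j) (a ∷ x) (b ∷ y) c = cong (does (a ≟ b) ∧_) (onLine-[]≔ j x y c)

  onLine⇒ : ∀ {n p} j (x y : Vec (Fin n) p) → onLine j x y ≡ true → y ≡ x [ j ]≔ lookup y j
  onLine⇒ zero (_ ∷ x) (b ∷ y) x≈y with ≡-dec _≟_ x y
  ... | yes refl = refl
  onLine⇒ (suc j) (a ∷ x) (b ∷ y) on with a ≟ b
  ... | yes refl = cong (a ∷_) (onLine⇒ j x y on)

  private
    ∑-if-∧ : ∀ {n} p (c : Bool) (e : Vec (Fin n) p → Bool) (G : Vec (Fin n) p → ℕ) →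
             ∑ᶜ p (λ y → if c ∧ e y then G y else 0) ≡ (if c then ∑ᶜ p (λ y → if e y then G y else 0) else 0)
    ∑-if-∧ p true e G = refl
    ∑-if-∧ p false e G = ∑ᶜ-zero p

  ∑ᶜ-at : ∀ {n} p (x : Vec (Fin n) p) (G : Vec (Fin n) p → ℕ) →
          ∑ᶜ p (λ y → if does (≡-dec _≟_ x y) then G y else 0) ≡ G x
  ∑ᶜ-at zero [] G = refl
  ∑ᶜ-at {n} (suc p) (a ∷ x) G = begin
    ∑ n (λ b → ∑ᶜ p (λ y → if does (a ≟ b) ∧ does (≡-dec _≟_ x y) then G (b ∷ y) else 0))
      ≡⟨ ∑-cong n (λ b → ∑-if-∧ p (does (a ≟ b)) _ _) ⟩
    ∑ n (λ b → if does (a ≟ b) then ∑ᶜ p (λ y → if does (≡-dec _≟_ x y) then G (b ∷ y) else 0) else 0)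
      ≡⟨ ∑-at n a _ ⟩
    ∑ᶜ p (λ y → if does (≡-dec _≟_ x y) then G (a ∷ y) else 0)
      ≡⟨ ∑ᶜ-at p x _ ⟩
    G (a ∷ x) ∎
    where open ≡-Reasoning

  ∑ᶜ-line : ∀ {n} p j (x : Vec (Fin n) p) (φ : Vec (Fin n) p → ℕ) →
            ∑ᶜ p (λ y → if onLine j x y then φ y else 0) ≡ ∑ n (λ a → φ (x [ j ]≔ a))
  ∑ᶜ-line {n} (suc p) zero (a ∷ x) φ = ∑-cong n (λ b → ∑ᶜ-at p x (λ y → φ (b ∷ y)))
  ∑ᶜ-line {n} (suc p) (suc j) (a ∷ x) φ = begin
    ∑ n (λ b → ∑ᶜ p (λ y → if does (a ≟ b) ∧ onLine j x y then φ (b ∷ y) else 0))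
      ≡⟨ ∑-cong n (λ b → ∑-if-∧ p (does (a ≟ b)) _ _) ⟩
    ∑ n (λ b → if does (a ≟ b) then ∑ᶜ p (λ y → if onLine j x y then φ (b ∷ y) else 0) else 0)
      ≡⟨ ∑-at n a _ ⟩
    ∑ᶜ p (λ y → if onLine j x y then φ (a ∷ y) else 0)
      ≡⟨ ∑ᶜ-line p j x _ ⟩
    ∑ n (λ c → φ (a ∷ x [ j ]≔ c)) ∎
    where open ≡-Reasoning

  _without_ : ∀ {p} → (Fin p → Bool) → Fin p → Fin p → Bool
  (free without j) l = free l ∧ not (does (l ≟ j))

  without⁻ : ∀ {p} (free : Fin p → Bool) j l → (free without j) l ≡ true → free l ≡ true × l ≢ j
  without⁻ free j l fl with free l | l ≟ j
  ... | true | no l≢j = refl , l≢j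

  KeepsFree : ∀ {n p} → (Fin p → Bool) → (Vec (Fin n) p → Vec (Fin n) p) → Set
  KeepsFree free ρ = ∀ x i → free i ≡ true → lookup (ρ x) i ≡ lookup x i

module CubeSets {n p : ℕ} where

  open import Data.Bool using (Bool; true; false; _∧_; not; if_then_else_)
  open import Data.Nat using (zero; suc; _+_; _*_; _^_; _≤_)
  open import Data.Nat.Properties hiding (_≟_)
  open import Data.Fin as Fin using (Fin)
  open import Data.Fin.Subset using (Subset; ∣_∣)
  open import Data.Vec using (Vec; lookup; tabulate; _[_]≔_)
  open import Data.Vec.Properties using ([]≔-idempotent; []≔-lookup; tabulate-cong)
  open import Data.Product using (Σ; _×_; _,_)
  open import Data.Bool.Properties using (_≟_; ¬-not)
  open import Relation.Nullary using (yes; no; does; contradiction)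
  open import Relation.Binary.PropositionalEquality
  open Sums
  open Search
  open Lines

  CubeSet : Set
  CubeSet = Vec (Fin n) p → Bool

  _⊆_ : CubeSet → CubeSet → Set
  S′ ⊆ S = ∀ x → S′ x ≡ true → S x ≡ true

  size : CubeSet → ℕ
  size S = ∑ᶜ p (λ x → 𝟙 (S x))

  fibre : Fin p → CubeSet → Vec (Fin n) p → Subset n
  fibre j S x = tabulate (λ a → S (x [ j ]≔ a))

  cylinder : Fin p → CubeSet → CubeSet
  cylinder j S y = anyᵇ n (λ a → S (y [ j ]≔ a))

  removeLine : Fin p → Vec (Fin n) p → CubeSet → CubeSet
  removeLine j x S y = S y ∧ not (onLine j x y)

  ∣fibre∣ : ∀ j S x → ∣ fibre j S x ∣ ≡ ∑ n (λ a → 𝟙 (S (x [ j ]≔ a)))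
  ∣fibre∣ j S x = ∣tabulate∣ n _
    where
    ∣tabulate∣ : ∀ m (f : Fin m → Bool) → ∣ tabulate {n = m} f ∣ ≡ ∑ m (λ a → 𝟙 (f a))
    ∣tabulate∣ zero f = refl
    ∣tabulate∣ (suc m) f with f Fin.zero
    ... | true = cong suc (∣tabulate∣ m _)
    ... | false = ∣tabulate∣ m _

  size-mono : ∀ {S′ S} → S′ ⊆ S → size S′ ≤ size S
  size-mono S′⊆S = ∑ᶜ-mono-≤ p (λ x → 𝟙-mono (S′⊆S x))

  size-full : size (λ _ → true) ≡ n ^ p
  size-full = trans (∑ᶜ-const p 1) (*-identityʳ (n ^ p))

  size≤ : ∀ S → size S ≤ n ^ p
  size≤ S = ≤-trans (size-mono (λ _ _ → refl)) (≤-reflexive size-full)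

  nonempty : ∀ S → 1 ≤ size S → Σ (Vec (Fin n) p) λ x → S x ≡ true
  nonempty S 1≤size with anyᶜ? p (λ x → S x ≟ true)
  ... | yes found = found
  ... | no none = contradiction (subst (1 ≤_) size≡0 1≤size) λ ()
    where
    size≡0 : size S ≡ 0
    size≡0 = trans (∑ᶜ-cong p (λ x → cong 𝟙 (¬-not (λ x∈S → none (x , x∈S))))) (∑ᶜ-zero p)

  ⊆-cylinder : ∀ j S → S ⊆ cylinder j S
  ⊆-cylinder j S x x∈S = anyᵇ⁺ n _ (lookup x j) (trans (cong S ([]≔-lookup x j)) x∈S)

  cylinder-mono : ∀ j {S′ S} → S′ ⊆ S → cylinder j S′ ⊆ cylinder j S
  cylinder-mono j S′⊆S y y∈C = let (a , ya∈S′) = anyᵇ⁻ n _ y∈C in anyᵇ⁺ n _ a (S′⊆S _ ya∈S′)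

  cylinder-[]≔ : ∀ j S x a → cylinder j S (x [ j ]≔ a) ≡ cylinder j S x
  cylinder-[]≔ j S x a = anyᵇ-cong n (λ b → cong S ([]≔-idempotent x j))

  removeLine-⊆ : ∀ j x S → removeLine j x S ⊆ S
  removeLine-⊆ j x S y y∈S′ with S y
  ... | true = refl

  size-removeLine : ∀ j x S → size S ≡ size (removeLine j x S) + ∣ fibre j S x ∣
  size-removeLine j x S = begin
    size S
      ≡⟨ ∑ᶜ-cong p split ⟩
    ∑ᶜ p (λ y → 𝟙 (removeLine j x S y) + (if onLine j x y then 𝟙 (S y) else 0))
      ≡⟨ ∑ᶜ-distrib-+ p _ _ ⟩
    size (removeLine j x S) + ∑ᶜ p (λ y → if onLine j x y then 𝟙 (S y) else 0)
      ≡⟨ cong (size (removeLine j x S) +_) (trans (∑ᶜ-line p j x _) (sym (∣fibre∣ j S x))) ⟩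
    size (removeLine j x S) + ∣ fibre j S x ∣ ∎
    where
    open ≡-Reasoning
    split : ∀ y → 𝟙 (S y) ≡ 𝟙 (removeLine j x S y) + (if onLine j x y then 𝟙 (S y) else 0)
    split y with onLine j x y | S y
    ... | true  | true  = refl
    ... | true  | false = refl
    ... | false | true  = refl
    ... | false | false = refl

  size-cylinder-removeLine : ∀ j x S → S x ≡ true →
    size (cylinder j S) ≡ size (cylinder j (removeLine j x S)) + n
  size-cylinder-removeLine j x S x∈S = begin
    size (cylinder j S)
      ≡⟨ ∑ᶜ-cong p split ⟩
    ∑ᶜ p (λ y → 𝟙 (cylinder j S′ y) + (if onLine j x y then 1 else 0))
      ≡⟨ ∑ᶜ-distrib-+ p _ _ ⟩
    size (cylinder j S′) + ∑ᶜ p (λ y → if onLine j x y then 1 else 0)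
      ≡⟨ cong (size (cylinder j S′) +_) (trans (∑ᶜ-line p j x _) (trans (∑-const n 1) (*-identityʳ n))) ⟩
    size (cylinder j S′) + n ∎
    where
    open ≡-Reasoning
    S′ : CubeSet
    S′ = removeLine j x S
    split : ∀ y → 𝟙 (cylinder j S y) ≡ 𝟙 (cylinder j S′ y) + (if onLine j x y then 1 else 0)
    split y with onLine j x y in y∼x
    ... | true = trans (cong 𝟙 C∋y) (cong (λ c → 𝟙 c + 1) (sym (anyᵇ-none n _ line-removed)))
      where
      C∋y : cylinder j S y ≡ true
      C∋y = anyᵇ⁺ n _ (lookup x j) (begin
        S (y [ j ]≔ lookup x j)                   ≡⟨ cong (λ t → S (t [ j ]≔ lookup x j)) (onLine⇒ j x y y∼x) ⟩
        S (x [ j ]≔ lookup y j [ j ]≔ lookup x j) ≡⟨ cong S (trans ([]≔-idempotent x j) ([]≔-lookup x j)) ⟩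
        S x                                       ≡⟨ x∈S ⟩
        true                                      ∎)
      line-removed : ∀ a → S′ (y [ j ]≔ a) ≡ false
      line-removed a rewrite onLine-[]≔ j x y a | y∼x with S (y [ j ]≔ a)
      ... | true = refl
      ... | false = refl
    ... | false = trans (cong 𝟙 (anyᵇ-cong n line-kept)) (sym (+-identityʳ _))
      where
      line-kept : ∀ a → S (y [ j ]≔ a) ≡ S′ (y [ j ]≔ a)
      line-kept a rewrite onLine-[]≔ j x y a | y∼x with S (y [ j ]≔ a)
      ... | true = refl
      ... | false = refl

  fibre-[]≔ : ∀ j S x a → fibre j S (x [ j ]≔ a) ≡ fibre j S x
  fibre-[]≔ j S x a = tabulate-cong (λ b → cong S ([]≔-idempotent x j))

  _∩_⁻¹_ : CubeSet → CubeSet → Bool → CubeSet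
  (S ∩ msg ⁻¹ b) x = S x ∧ does (msg x ≟ b)

  ∩⁻¹-⊆ : ∀ S msg b x → (S ∩ msg ⁻¹ b) x ≡ true → S x ≡ true × msg x ≡ b
  ∩⁻¹-⊆ S msg b x x∈ with S x | msg x ≟ b
  ... | true | yes msg≡b = refl , msg≡b

  size-split : ∀ S msg → size S ≡ size (S ∩ msg ⁻¹ false) + size (S ∩ msg ⁻¹ true)
  size-split S msg = trans (∑ᶜ-cong p split) (∑ᶜ-distrib-+ p _ _)
    where
    split : ∀ x → 𝟙 (S x) ≡ 𝟙 ((S ∩ msg ⁻¹ false) x) + 𝟙 ((S ∩ msg ⁻¹ true) x)
    split x with S x | msg x
    ... | true  | true  = refl
    ... | true  | false = refl
    ... | false | _     = refl

  largerPart : ∀ S msg → Σ Bool λ b → size S ≤ 2 * size (S ∩ msg ⁻¹ b)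
  largerPart S msg with size (S ∩ msg ⁻¹ false) ≤? size (S ∩ msg ⁻¹ true)
  ... | yes S₀≤S₁ = true , (begin
    size S                                         ≡⟨ size-split S msg ⟩
    size (S ∩ msg ⁻¹ false) + size (S ∩ msg ⁻¹ true) ≤⟨ +-monoˡ-≤ _ S₀≤S₁ ⟩
    size (S ∩ msg ⁻¹ true) + size (S ∩ msg ⁻¹ true)  ≡⟨ cong (size (S ∩ msg ⁻¹ true) +_) (+-identityʳ _) ⟨
    2 * size (S ∩ msg ⁻¹ true)                       ∎)
    where open ≤-Reasoning
  ... | no S₀≰S₁ = false , (begin
    size S                                            ≡⟨ size-split S msg ⟩
    size (S ∩ msg ⁻¹ false) + size (S ∩ msg ⁻¹ true)  ≤⟨ +-monoʳ-≤ _ (<⇒≤ (≰⇒> S₀≰S₁)) ⟩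
    size (S ∩ msg ⁻¹ false) + size (S ∩ msg ⁻¹ false) ≡⟨ cong (size (S ∩ msg ⁻¹ false) +_) (+-identityʳ _) ⟨
    2 * size (S ∩ msg ⁻¹ false)                       ∎)
    where open ≤-Reasoning

  ∣fibre∣-mono : ∀ l S y S′ x → (∀ c → S (y [ l ]≔ c) ≡ true → S′ (x [ l ]≔ c) ≡ true) →
                 ∣ fibre l S y ∣ ≤ ∣ fibre l S′ x ∣
  ∣fibre∣-mono l S y S′ x into = begin
    ∣ fibre l S y ∣                    ≡⟨ ∣fibre∣ l S y ⟩
    ∑ n (λ c → 𝟙 (S (y [ l ]≔ c)))     ≤⟨ ∑-mono-≤ n (λ c → 𝟙-mono (into c)) ⟩
    ∑ n (λ c → 𝟙 (S′ (x [ l ]≔ c)))    ≡⟨ ∣fibre∣ l S′ x ⟨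
    ∣ fibre l S′ x ∣                   ∎
    where open ≤-Reasoning

module Thickness {n p : ℕ} (h : ℕ) (free : Fin p → Bool) where

  open import Data.Bool using (true; false; if_then_else_) renaming (_≟_ to _≟ᵇ_)
  open import Data.Nat using (_+_; _*_; _^_; _≤_; _<_; _<?_; z≤n; >-nonZero)
  open import Data.Nat.Properties hiding (_≟_)
  open import Data.Nat.Induction using (<-wellFounded)
  open import Data.Fin.Properties using (any?; _≟_)
  open import Data.Fin.Subset using (∣_∣)
  open import Data.List using ([]; _∷_)
  open import Data.Vec using (Vec; lookup; _[_]≔_)
  open import Data.Vec.Properties using ([]≔-lookup; []≔-commutes)
  open import Data.Product using (Σ; _×_; _,_; proj₁)
  open import Induction.WellFounded using (Acc; acc)
  open import Relation.Nullary using (Dec; yes; no; _×-dec_)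
  open import Relation.Binary.PropositionalEquality
  import Data.Nat.Tactic.RingSolver as Ring
  open Sums
  open Search
  open CubeSets {n} {p}

  Thick : CubeSet → Set
  Thick S = ∀ j x → free j ≡ true → S x ≡ true → n ≤ 2 ^ h * ∣ fibre j S x ∣

  cylinderTotal : CubeSet → ℕ
  cylinderTotal S = ∑ p (λ j → if free j then size (cylinder j S) else 0)

  cylinderTotal-mono : ∀ {S′ S} → S′ ⊆ S → cylinderTotal S′ ≤ cylinderTotal S
  cylinderTotal-mono {S′} {S} S′⊆S = ∑-mono-≤ p term
    where
    term : ∀ j → (if free j then size (cylinder j S′) else 0) ≤ (if free j then size (cylinder j S) else 0)
    term j with free j
    ... | true = size-mono (cylinder-mono j S′⊆S)
    ... | false = ≤-refl

  cylinderTotal-removeLine : ∀ j x S → free j ≡ true → S x ≡ true →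
    cylinderTotal (removeLine j x S) + n ≤ cylinderTotal S
  cylinderTotal-removeLine j x S fj x∈S = ∑-mono-≤-gap p n j term term-j
    where
    term : ∀ i → (if free i then size (cylinder i (removeLine j x S)) else 0) ≤ (if free i then size (cylinder i S) else 0)
    term i with free i
    ... | true = size-mono (cylinder-mono i (removeLine-⊆ j x S))
    ... | false = ≤-refl
    term-j : (if free j then size (cylinder j (removeLine j x S)) else 0) + n ≤ (if free j then size (cylinder j S) else 0)
    term-j rewrite fj = ≤-reflexive (sym (size-cylinder-removeLine j x S x∈S))

  -- Each point of S missing from S″ is paid for, at rate 2ʰ, by a decrease of the cylinder total.
  _⊑_ : CubeSet → CubeSet → Set
  S″ ⊑ S = S″ ⊆ S × 2 ^ h * size S + cylinderTotal S″ ≤ 2 ^ h * size S″ + cylinderTotal S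

  ⊑-refl : ∀ {S} → S ⊑ S
  ⊑-refl = (λ x x∈S → x∈S) , ≤-refl

  ⊑-trans : ∀ {S‴ S″ S} → S‴ ⊑ S″ → S″ ⊑ S → S‴ ⊑ S
  ⊑-trans {S‴} {S″} {S} (S‴⊆S″ , cost₁) (S″⊆S , cost₂) =
    (λ x x∈S‴ → S″⊆S x (S‴⊆S″ x x∈S‴)) ,
    add-and-cancel (2 ^ h * size S) (2 ^ h * size S″) (2 ^ h * size S‴) _ _ _ cost₁ cost₂
    where
    add-and-cancel : ∀ s s₂ s₃ f f₂ f₃ → s₂ + f₃ ≤ s₃ + f₂ → s + f₂ ≤ s₂ + f → s + f₃ ≤ s₃ + f
    add-and-cancel s s₂ s₃ f f₂ f₃ le₁ le₂ = +-cancelʳ-≤ (s₂ + f₂) (s + f₃) (s₃ + f) (begin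
      s + f₃ + (s₂ + f₂) ≡⟨ Ring.solve (s ∷ s₂ ∷ f₂ ∷ f₃ ∷ []) ⟩
      s + f₂ + (s₂ + f₃) ≤⟨ +-mono-≤ le₂ le₁ ⟩
      s₂ + f + (s₃ + f₂) ≡⟨ Ring.solve (s₂ ∷ s₃ ∷ f ∷ f₂ ∷ []) ⟩
      s₃ + f + (s₂ + f₂) ∎)
      where open ≤-Reasoning

  ThinAt : CubeSet → Fin p → Vec (Fin n) p → Set
  ThinAt S j x = free j ≡ true × S x ≡ true × 2 ^ h * ∣ fibre j S x ∣ < n

  thinAt? : ∀ S j x → Dec (ThinAt S j x)
  thinAt? S j x = (free j ≟ᵇ true) ×-dec (S x ≟ᵇ true) ×-dec (2 ^ h * ∣ fibre j S x ∣ <? n)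

  removeThinLine-⊑ : ∀ {S j x} → ThinAt S j x → removeLine j x S ⊑ S
  removeThinLine-⊑ {S} {j} {x} (fj , x∈S , thin) = removeLine-⊆ j x S , (begin
    2 ^ h * size S + cylinderTotal S′
      ≡⟨ cong (λ t → 2 ^ h * t + cylinderTotal S′) (size-removeLine j x S) ⟩
    2 ^ h * (size S′ + ∣ fibre j S x ∣) + cylinderTotal S′
      ≡⟨ cong (_+ cylinderTotal S′) (*-distribˡ-+ (2 ^ h) (size S′) _) ⟩
    2 ^ h * size S′ + 2 ^ h * ∣ fibre j S x ∣ + cylinderTotal S′
      ≤⟨ +-monoˡ-≤ (cylinderTotal S′) (+-monoʳ-≤ (2 ^ h * size S′) (<⇒≤ thin)) ⟩
    2 ^ h * size S′ + n + cylinderTotal S′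
      ≡⟨ +-assoc (2 ^ h * size S′) n _ ⟩
    2 ^ h * size S′ + (n + cylinderTotal S′)
      ≤⟨ +-monoʳ-≤ (2 ^ h * size S′) (≤-trans (≤-reflexive (+-comm n _)) (cylinderTotal-removeLine j x S fj x∈S)) ⟩
    2 ^ h * size S′ + cylinderTotal S ∎)
    where
    open ≤-Reasoning
    S′ : CubeSet
    S′ = removeLine j x S

  size-removeThinLine : ∀ {S j x} → ThinAt S j x → size (removeLine j x S) < size S
  size-removeThinLine {S} {j} {x} (_ , x∈S , _) = begin-strict
    size (removeLine j x S)                    <⟨ m<m+n _ x∈fibre ⟩
    size (removeLine j x S) + ∣ fibre j S x ∣  ≡⟨ size-removeLine j x S ⟨
    size S                                     ∎
    where
    open ≤-Reasoning
    x∈fibre : 1 ≤ ∣ fibre j S x ∣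
    x∈fibre = begin
      1                                    ≡⟨ cong 𝟙 (trans (cong S ([]≔-lookup x j)) x∈S) ⟨
      𝟙 (S (x [ j ]≔ lookup x j))          ≤⟨ ∑-term-≤ n (λ a → 𝟙 (S (x [ j ]≔ a))) (lookup x j) ⟩
      ∑ n (λ a → 𝟙 (S (x [ j ]≔ a)))       ≡⟨ ∣fibre∣ j S x ⟨
      ∣ fibre j S x ∣                      ∎

  thicken : ∀ S → Σ CubeSet λ S″ → S″ ⊑ S × Thick S″
  thicken S = go S (<-wellFounded (size S))
    where
    go : ∀ S → Acc _<_ (size S) → Σ CubeSet λ S″ → S″ ⊑ S × Thick S″
    go S (acc smaller) with any? (λ j → anyᶜ? p (thinAt? S j))
    ... | no noThin = S , ⊑-refl , λ j x fj x∈S → ≮⇒≥ (λ thin → noThin (j , x , fj , x∈S , thin))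
    ... | yes (j , x , thin) =
      let (S″ , S″⊑S′ , thick) = go (removeLine j x S) (smaller (size-removeThinLine thin))
      in S″ , ⊑-trans S″⊑S′ (removeThinLine-⊑ thin) , thick

  Spread : CubeSet → Set
  Spread S = ∀ j → free j ≡ true → 6 * p * size (cylinder j S) ≤ 2 ^ h * size S

  cylinderTotal-spread : ∀ S → Spread S → 6 * p * cylinderTotal S ≤ p * (2 ^ h * size S)
  cylinderTotal-spread S spread = begin
    6 * p * cylinderTotal S                                          ≡⟨ ∑-*ˡ p (6 * p) _ ⟨
    ∑ p (λ j → 6 * p * (if free j then size (cylinder j S) else 0))  ≤⟨ ∑-mono-≤ p term ⟩
    ∑ p (λ _ → 2 ^ h * size S)                                       ≡⟨ ∑-const p _ ⟩
    p * (2 ^ h * size S)                                             ∎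
    where
    open ≤-Reasoning
    term : ∀ j → 6 * p * (if free j then size (cylinder j S) else 0) ≤ 2 ^ h * size S
    term j with free j in fj
    ... | true = spread j fj
    ... | false = ≤-trans (≤-reflexive (*-zeroʳ (6 * p))) z≤n

  thicken-spread : ∀ {S S′ S″} → 1 ≤ p → Spread S → S′ ⊆ S → S″ ⊑ S′ → 6 * size S′ ≤ 6 * size S″ + size S
  thicken-spread {S} {S′} {S″} 1≤p spread S′⊆S (_ , cost) =
    *-cancelˡ-≤ (p * 2 ^ h) {{>-nonZero (*-mono-≤ 1≤p (m^n>0 2 h))}} (begin
      p * 2 ^ h * (6 * size S′)                                    ≡⟨ shuffle₁ p (2 ^ h) (size S′) ⟩
      6 * p * (2 ^ h * size S′)                                    ≤⟨ *-monoʳ-≤ (6 * p) (≤-trans (m≤m+n _ _) cost) ⟩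
      6 * p * (2 ^ h * size S″ + cylinderTotal S′)                 ≡⟨ *-distribˡ-+ (6 * p) _ _ ⟩
      6 * p * (2 ^ h * size S″) + 6 * p * cylinderTotal S′         ≤⟨ +-monoʳ-≤ _ lost ⟩
      6 * p * (2 ^ h * size S″) + p * (2 ^ h * size S)             ≡⟨ shuffle₂ p (2 ^ h) (size S″) (size S) ⟩
      p * 2 ^ h * (6 * size S″ + size S)                           ∎)
    where
    open ≤-Reasoning
    shuffle₁ : ∀ p K s → p * K * (6 * s) ≡ 6 * p * (K * s)
    shuffle₁ = Ring.solve-∀
    shuffle₂ : ∀ p K s t → 6 * p * (K * s) + p * (K * t) ≡ p * K * (6 * s + t)
    shuffle₂ = Ring.solve-∀
    lost : 6 * p * cylinderTotal S′ ≤ p * (2 ^ h * size S)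
    lost = ≤-trans (*-monoʳ-≤ (6 * p) (cylinderTotal-mono S′⊆S)) (cylinderTotal-spread S spread)

  splitThick : 1 ≤ p → ∀ S → Spread S → (msg : CubeSet) →
    Σ Bool λ b → Σ CubeSet λ S″ → S″ ⊆ (S ∩ msg ⁻¹ b) × Thick S″ × size S ≤ 3 * size S″
  splitThick 1≤p S spread msg =
    let (b , half) = largerPart S msg
        (S″ , S″⊑Sb , thick) = thicken (S ∩ msg ⁻¹ b)
        loss = thicken-spread 1≤p spread (λ x x∈Sb → proj₁ (∩⁻¹-⊆ S msg b x x∈Sb)) S″⊑Sb
    in b , S″ , proj₁ S″⊑Sb , thick , third (size S) (size (S ∩ msg ⁻¹ b)) (size S″) half loss
    where
    third : ∀ s s′ s″ → s ≤ 2 * s′ → 6 * s′ ≤ 6 * s″ + s → s ≤ 3 * s″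
    third s s′ s″ half loss = *-cancelˡ-≤ 2 (+-cancelˡ-≤ s (2 * s) (2 * (3 * s″)) (begin
      s + 2 * s         ≡⟨ triple s ⟩
      3 * s             ≤⟨ *-monoʳ-≤ 3 half ⟩
      3 * (2 * s′)      ≡⟨ *-assoc 3 2 s′ ⟨
      6 * s′            ≤⟨ loss ⟩
      6 * s″ + s        ≡⟨ +-comm (6 * s″) s ⟩
      s + 6 * s″        ≡⟨ cong (s +_) (*-assoc 2 3 s″) ⟩
      s + 2 * (3 * s″)  ∎))
      where
      open ≤-Reasoning
      triple : ∀ s → s + 2 * s ≡ 3 * s
      triple = Ring.solve-∀

  thick-on-cylinder : ∀ {S} j x → Thick S → free j ≡ true → cylinder j S x ≡ true → n ≤ 2 ^ h * ∣ fibre j S x ∣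
  thick-on-cylinder {S} j x thick fj x∈C =
    let (a , xa∈S) = anyᵇ⁻ n _ x∈C
    in subst (λ F → n ≤ 2 ^ h * ∣ F ∣) (fibre-[]≔ j S x a) (thick j (x [ j ]≔ a) fj xa∈S)

  cylinder-thick : ∀ j S → Thick S → Thick (cylinder j S)
  cylinder-thick j S thick l x fl x∈C with l ≟ j
  ... | yes refl = begin
    n                                 ≤⟨ m≤n*m n (2 ^ h) {{m^n≢0 2 h}} ⟩
    2 ^ h * n                         ≡⟨ cong (2 ^ h *_) full ⟨
    2 ^ h * ∣ fibre l (cylinder l S) x ∣ ∎
    where
    open ≤-Reasoning
    full : ∣ fibre l (cylinder l S) x ∣ ≡ n
    full = begin-equality
      ∣ fibre l (cylinder l S) x ∣                    ≡⟨ ∣fibre∣ l (cylinder l S) x ⟩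
      ∑ n (λ a → 𝟙 (cylinder l S (x [ l ]≔ a)))       ≡⟨ ∑-cong n (λ a → cong 𝟙 (trans (cylinder-[]≔ l S x a) x∈C)) ⟩
      ∑ n (λ _ → 1)                                   ≡⟨ trans (∑-const n 1) (*-identityʳ n) ⟩
      n                                               ∎
  ... | no l≢j = let (a , xa∈S) = anyᵇ⁻ n _ x∈C in begin
    n                                    ≤⟨ thick l (x [ j ]≔ a) fl xa∈S ⟩
    2 ^ h * ∣ fibre l S (x [ j ]≔ a) ∣   ≤⟨ *-monoʳ-≤ (2 ^ h) (∣fibre∣-mono l S _ (cylinder j S) x into) ⟩
    2 ^ h * ∣ fibre l (cylinder j S) x ∣ ∎
    where
    open ≤-Reasoning
    into : ∀ {a} c → S (x [ j ]≔ a [ l ]≔ c) ≡ true → cylinder j S (x [ l ]≔ c) ≡ true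
    into {a} c e = anyᵇ⁺ n _ a (trans (cong S ([]≔-commutes x l j l≢j)) e)

module Restriction where

  open import Data.Bool using (Bool; true; false; _∧_; not)
  open import Data.Bool.Properties using (_≟_)
  open import Data.Nat using (ℕ; _<ᵇ_; _^_; _≤_; _+_; z≤n; s≤s)
  open import Data.Nat.Properties using (≤-refl; ≤-reflexive; ≤-trans; *-monoʳ-≤)
  open import Data.Fin using (Fin; zero; suc)
  open import Data.Fin.Properties using (any?)
  open import Data.Fin.Subset using (Subset; ∣_∣; _∩_)
  open import Data.Vec using (Vec; []; _∷_; lookup; _[_]≔_)
  open import Data.Vec.Properties using (lookup∘tabulate; lookup∘updateAt; lookup∘updateAt′; []≔-commutes)
  open import Data.Product using (Σ; _×_; _,_)
  open import Relation.Nullary using (yes; no; contradiction)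
  open import Relation.Binary.PropositionalEquality
  open Sums
  open Search
  open Lines
  open CubeSets

  meets : ∀ {n} → Subset n → Subset n → Bool
  meets U X = 0 <ᵇ ∣ U ∩ X ∣

  meets⁻ : ∀ {n} (U X : Subset n) → meets U X ≡ true → Σ (Fin n) λ a → lookup U a ≡ true × lookup X a ≡ true
  meets⁻ [] [] ()
  meets⁻ (true ∷ U) (true ∷ X) _ = zero , refl , refl
  meets⁻ (true ∷ U) (false ∷ X) m = let (a , a∈U , a∈X) = meets⁻ U X m in suc a , a∈U , a∈X
  meets⁻ (false ∷ U) (_ ∷ X) m = let (a , a∈U , a∈X) = meets⁻ U X m in suc a , a∈U , a∈X

  meets⁺ : ∀ {n} (U X : Subset n) a → lookup U a ≡ true → lookup X a ≡ true → meets U X ≡ true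
  meets⁺ (true ∷ U) (true ∷ X) zero _ _ = refl
  meets⁺ (u ∷ U) (x ∷ X) (suc a) a∈U a∈X with meets⁺ U X a a∈U a∈X
  ... | m with u | x
  ... | true  | true  = refl
  ... | true  | false = m
  ... | false | _     = m

  module _ {n p : ℕ} (j : Fin p) (S : CubeSet {n} {p}) (U : Subset n) where

    restricted : CubeSet {n} {p}
    restricted x = meets U (fibre j S x)

    restricted-⊆ : restricted ⊆ cylinder j S
    restricted-⊆ x x∈R =
      let (a , _ , a∈F) = meets⁻ U _ x∈R
      in anyᵇ⁺ n _ a (trans (sym (lookup∘tabulate _ a)) a∈F)

    size-cylinder≤ : size (cylinder j S) ≤ size restricted + size (λ x → cylinder j S x ∧ not (restricted x))
    size-cylinder≤ = ≤-trans (∑ᶜ-mono-≤ p split) (≤-reflexive (∑ᶜ-distrib-+ p _ _))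
      where
      split : ∀ x → 𝟙 (cylinder j S x) ≤ 𝟙 (restricted x) + 𝟙 (cylinder j S x ∧ not (restricted x))
      split x with cylinder j S x | restricted x
      ... | true  | true  = s≤s z≤n
      ... | true  | false = ≤-refl
      ... | false | _     = z≤n

    restricted-thick : ∀ h free → Thickness.Thick h free S → Thickness.Thick h (free without j) restricted
    restricted-thick h free thick l x fl x∈R =
      let (free-l , l≢j) = without⁻ free j l fl
          (a , a∈U , a∈F) = meets⁻ U _ x∈R
          xa∈S = trans (sym (lookup∘tabulate _ a)) a∈F
          into : ∀ c → S (x [ j ]≔ a [ l ]≔ c) ≡ true → restricted (x [ l ]≔ c) ≡ true
          into c e = meets⁺ U _ a a∈U (trans (lookup∘tabulate _ a) (trans (cong S ([]≔-commutes x l j l≢j)) e))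
      in ≤-trans (thick l (x [ j ]≔ a) free-l xa∈S) (*-monoʳ-≤ (2 ^ h) (∣fibre∣-mono l S _ restricted x into))

    -- relabel ρ x moves x along its j-line to a point of S whose j-th coordinate lies in U (when
    -- there is one) and then applies ρ, so the j-th coordinate of x itself is forgotten.
    relabel : (Vec (Fin n) p → Vec (Fin n) p) → Vec (Fin n) p → Vec (Fin n) p
    relabel ρ x with any? (λ a → (lookup U a ∧ S (x [ j ]≔ a)) ≟ true)
    ... | yes (a , _) = ρ (x [ j ]≔ a)
    ... | no _ = ρ x

    relabel-keepsFree : ∀ free ρ → KeepsFree free ρ → KeepsFree (free without j) (relabel ρ)
    relabel-keepsFree free ρ keeps x i fi with without⁻ free j i fi | any? (λ a → (lookup U a ∧ S (x [ j ]≔ a)) ≟ true)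
    ... | free-i , i≢j | yes (a , _) = trans (keeps (x [ j ]≔ a) i free-i) (lookup∘updateAt′ i j i≢j x)
    ... | free-i , _   | no _ = keeps x i free-i

    relabel-restricted : ∀ free ρ → KeepsFree free ρ → free j ≡ true → ∀ x → restricted x ≡ true →
      Σ (Fin n) λ a → relabel ρ x ≡ ρ (x [ j ]≔ a) × lookup U a ≡ true × S (x [ j ]≔ a) ≡ true × lookup (relabel ρ x) j ≡ a
    relabel-restricted free ρ keeps fj x x∈R with any? (λ a → (lookup U a ∧ S (x [ j ]≔ a)) ≟ true)
    ... | yes (a , both) = a , refl , a∈U , xa∈S , trans (keeps (x [ j ]≔ a) j fj) (lookup∘updateAt j x)
      where
      a∈U : lookup U a ≡ true
      a∈U = ∧-true₁ both
      xa∈S : S (x [ j ]≔ a) ≡ true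
      xa∈S = ∧-true₂ {lookup U a} both
    ... | no none =
      let (a , a∈U , a∈F) = meets⁻ U _ x∈R
      in contradiction (a , trans (cong (_∧ S (x [ j ]≔ a)) a∈U) (trans (sym (lookup∘tabulate _ a)) a∈F)) none

module Expectation {na nb : ℕ} where

  open import Data.Bool using (true; false; not)
  open import Data.Bool.Properties using (_≟_; ¬-not)
  open import Data.Nat as ℕ using (zero; suc; z≤n; s≤s)
  open import Data.Nat.Properties as ℕ using ()
  open import Data.Fin as Fin using (Fin)
  open import Data.Vec using (Vec; []; _∷_)
  open import Data.List using ([]; _∷_)
  open import Data.List.Relation.Unary.All using (All; []; _∷_)
  import Data.List.Relation.Unary.All as All
  open import Data.Product using (Σ; _×_; _,_)
  open import Data.Sum using (_⊎_; inj₁; inj₂)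
  open import Data.Unit using (tt)
  import Data.Integer as ℤ
  open import Data.Rational using (ℚ; 0ℚ; 1ℚ; _+_; _-_; _/_; _≤_; _<_)
  open import Data.Rational.Properties hiding (_≟_)
  open import Data.Rational.Solver using (module +-*-Solver)
  open +-*-Solver
  open import Algebra.Bundles using (CommutativeMonoid)
  open import Algebra.Properties.CommutativeMonoid.Mult +-0-commutativeMonoid
    using () renaming ( _×_ to infixr 8 _·_ ; ×-homo-+ to ·-homo-+ ; ×-assocˡ to ·-assocˡ
                      ; ×-homo-1 to ·-homo-1 ; ×-distrib-+ to ·-distrib-+ )
  open import Algebra.Properties.CommutativeSemigroup (CommutativeMonoid.commutativeSemigroup +-0-commutativeMonoid)
    using (interchange)
  open import Relation.Nullary using (¬_; Dec; yes; no; contradiction)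
  open import Relation.Nullary.Decidable using (toWitness)
  open import Relation.Binary.PropositionalEquality
  open import Defs using (Rectangle; RectDist; totalWeight; AllNonneg; []; _∷_; SupportedOn; intersects; probHit)
  open Sums

  ·-nonneg : ∀ {w} k → 0ℚ ≤ w → 0ℚ ≤ k · w
  ·-nonneg zero 0≤w = ≤-refl
  ·-nonneg (suc k) 0≤w = ≤-trans (≤-reflexive (sym (+-identityˡ 0ℚ))) (+-mono-≤ 0≤w (·-nonneg k 0≤w))

  ·-monoˡ-≤ : ∀ {w m k} → 0ℚ ≤ w → m ℕ.≤ k → m · w ≤ k · w
  ·-monoˡ-≤ {k = k} 0≤w z≤n = ·-nonneg k 0≤w
  ·-monoˡ-≤ {w} 0≤w (s≤s m≤k) = +-monoʳ-≤ w (·-monoˡ-≤ 0≤w m≤k)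

  ·-monoʳ-≤ : ∀ {w v} k → w ≤ v → k · w ≤ k · v
  ·-monoʳ-≤ zero w≤v = ≤-refl
  ·-monoʳ-≤ (suc k) w≤v = +-mono-≤ w≤v (·-monoʳ-≤ k w≤v)

  ·-monoʳ-< : ∀ {w v} k → w < v → suc k · w < suc k · v
  ·-monoʳ-< k w<v = +-mono-<-≤ w<v (·-monoʳ-≤ k (<⇒≤ w<v))

  𝔼 : RectDist na nb → (Rectangle na nb → ℕ) → ℚ
  𝔼 [] F = 0ℚ
  𝔼 ((w , R) ∷ σ) F = F R · w + 𝔼 σ F

  𝔼-mono-≤ : ∀ {σ} {F G : Rectangle na nb → ℕ} → AllNonneg σ → All (λ (_ , R) → F R ℕ.≤ G R) σ → 𝔼 σ F ≤ 𝔼 σ G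
  𝔼-mono-≤ [] [] = ≤-refl
  𝔼-mono-≤ (0≤w ∷ nonneg) (F≤G ∷ F≤Gs) = +-mono-≤ (·-monoˡ-≤ 0≤w F≤G) (𝔼-mono-≤ nonneg F≤Gs)

  𝔼-const : ∀ σ k → 𝔼 σ (λ _ → k) ≡ k · totalWeight σ
  𝔼-const [] k = sym (·-zeroʳ k)
    where
    ·-zeroʳ : ∀ k → k · 0ℚ ≡ 0ℚ
    ·-zeroʳ zero = refl
    ·-zeroʳ (suc k) = trans (+-identityˡ _) (·-zeroʳ k)
  𝔼-const ((w , R) ∷ σ) k = trans (cong (k · w +_) (𝔼-const σ k)) (sym (·-distrib-+ w _ k))

  𝔼-+ : ∀ σ (F G : Rectangle na nb → ℕ) → 𝔼 σ (λ R → F R ℕ.+ G R) ≡ 𝔼 σ F + 𝔼 σ G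
  𝔼-+ [] F G = sym (+-identityˡ 0ℚ)
  𝔼-+ ((w , R) ∷ σ) F G =
    trans (cong₂ _+_ (·-homo-+ w (F R) (G R)) (𝔼-+ σ F G)) (interchange (F R · w) (G R · w) (𝔼 σ F) (𝔼 σ G))

  𝔼-zero : ∀ σ → 𝔼 σ (λ _ → 0) ≡ 0ℚ
  𝔼-zero [] = refl
  𝔼-zero ((w , R) ∷ σ) = trans (+-identityˡ _) (𝔼-zero σ)

  𝔼-miss+probHit : ∀ σ X Y → 𝔼 σ (λ R → 𝟙 (not (intersects R X Y))) + probHit σ X Y ≡ totalWeight σ
  𝔼-miss+probHit [] X Y = refl
  𝔼-miss+probHit ((w , R) ∷ σ) X Y with intersects R X Y
  ... | true = begin
    0ℚ + M + (w + P) ≡⟨ cong (_+ (w + P)) (+-identityˡ M) ⟩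
    M + (w + P)      ≡⟨ +-assoc M w P ⟨
    M + w + P        ≡⟨ cong (_+ P) (+-comm M w) ⟩
    w + M + P        ≡⟨ +-assoc w M P ⟩
    w + (M + P)      ≡⟨ cong (w +_) (𝔼-miss+probHit σ X Y) ⟩
    w + totalWeight σ ∎
    where
    open ≡-Reasoning
    M P : ℚ
    M = 𝔼 σ (λ R → 𝟙 (not (intersects R X Y)))
    P = probHit σ X Y
  ... | false = begin
    1 · w + M + (0ℚ + P) ≡⟨ cong₂ (λ s t → s + M + t) (·-homo-1 w) (+-identityˡ P) ⟩
    w + M + P            ≡⟨ +-assoc w M P ⟩
    w + (M + P)          ≡⟨ cong (w +_) (𝔼-miss+probHit σ X Y) ⟩
    w + totalWeight σ    ∎
    where
    open ≡-Reasoning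
    M P : ℚ
    M = 𝔼 σ (λ R → 𝟙 (not (intersects R X Y)))
    P = probHit σ X Y

  probHit-none : ∀ (σ : RectDist na nb) X Y → All (λ (_ , R) → intersects R X Y ≡ false) σ → probHit σ X Y ≡ 0ℚ
  probHit-none [] X Y [] = refl
  probHit-none ((w , R) ∷ σ) X Y (miss ∷ misses) rewrite miss = trans (+-identityˡ _) (probHit-none σ X Y misses)

  searchSupport : ∀ {P Q : Rectangle na nb → Set} → (∀ R → Dec (Q R)) → ∀ σ → SupportedOn P σ →
                  (Σ (Rectangle na nb) λ R → P R × Q R) ⊎ All (λ (_ , R) → ¬ Q R) σ
  searchSupport Q? [] [] = inj₂ []
  searchSupport Q? ((w , R) ∷ σ) (PR ∷ Pσ) with Q? R
  ... | yes QR = inj₁ (R , PR , QR)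
  ... | no ¬QR with searchSupport Q? σ Pσ
  ...   | inj₁ found = inj₁ found
  ...   | inj₂ none = inj₂ (¬QR ∷ none)

  module _ (δ : ℚ) where

    record Bounded (σ : RectDist na nb) (F : Rectangle na nb → ℕ) (c : ℕ) : Set where
      constructor bounded
      field bound : 𝔼 σ F ≤ c · δ

    Bounded-zero : ∀ σ → Bounded σ (λ _ → 0) 0
    Bounded-zero σ = bounded (≤-reflexive (𝔼-zero σ))

    Bounded-+ : ∀ σ {F G c d} → Bounded σ F c → Bounded σ G d → Bounded σ (λ R → F R ℕ.+ G R) (c ℕ.+ d)
    Bounded-+ σ {F} {G} {c} {d} (bounded F≤) (bounded G≤) = bounded (begin
      𝔼 σ (λ R → F R ℕ.+ G R) ≡⟨ 𝔼-+ σ F G ⟩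
      𝔼 σ F + 𝔼 σ G           ≤⟨ +-mono-≤ F≤ G≤ ⟩
      c · δ + d · δ           ≡⟨ ·-homo-+ δ c d ⟨
      (c ℕ.+ d) · δ           ∎)
      where open ≤-Reasoning

    Bounded-* : ∀ σ k {F c} → Bounded σ F c → Bounded σ (λ R → k ℕ.* F R) (k ℕ.* c)
    Bounded-* σ zero F≤ = Bounded-zero σ
    Bounded-* σ (suc k) F≤ = Bounded-+ σ F≤ (Bounded-* σ k F≤)

    Bounded-∑ : ∀ σ m {F : Fin m → Rectangle na nb → ℕ} {c : Fin m → ℕ} → (∀ a → Bounded σ (F a) (c a)) →
                Bounded σ (λ R → ∑ m (λ a → F a R)) (∑ m c)
    Bounded-∑ σ zero F≤ = Bounded-zero σ
    Bounded-∑ σ (suc m) F≤ = Bounded-+ σ (F≤ Fin.zero) (Bounded-∑ σ m (λ a → F≤ (Fin.suc a)))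

    Bounded-∑ᶜ : ∀ σ {n} p {F : Vec (Fin n) p → Rectangle na nb → ℕ} {c : Vec (Fin n) p → ℕ} →
                 (∀ x → Bounded σ (F x) (c x)) → Bounded σ (λ R → ∑ᶜ p (λ x → F x R)) (∑ᶜ p c)
    Bounded-∑ᶜ σ zero F≤ = F≤ []
    Bounded-∑ᶜ σ {n} (suc p) F≤ = Bounded-∑ σ n (λ a → Bounded-∑ᶜ σ p (λ x → F≤ (a ∷ x)))

    miss-bounded : ∀ σ X Y → totalWeight σ ≡ 1ℚ → 1ℚ - δ ≤ probHit σ X Y →
                   Bounded σ (λ R → 𝟙 (not (intersects R X Y))) 1
    miss-bounded σ X Y total hit = bounded (begin
      M                        ≡⟨ solve 2 (λ m p → m := (m :+ p) :- p) refl M P ⟩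
      (M + P) - P              ≡⟨ cong (_- P) (trans (𝔼-miss+probHit σ X Y) total) ⟩
      1ℚ - P                   ≤⟨ +-monoʳ-≤ 1ℚ (neg-antimono-≤ hit) ⟩
      1ℚ - (1ℚ - δ)            ≡⟨ solve 1 (λ d → con 1ℚ :- (con 1ℚ :- d) := d) refl δ ⟩
      δ                        ≡⟨ ·-homo-1 δ ⟨
      1 · δ                    ∎)
      where
      open ≤-Reasoning
      M = 𝔼 σ (λ R → 𝟙 (not (intersects R X Y)))
      P = probHit σ X Y

    hit-exists : ∀ {P} σ X Y → SupportedOn P σ → δ < 1ℚ → 1ℚ - δ ≤ probHit σ X Y →
                 Σ (Rectangle na nb) λ R → P R × intersects R X Y ≡ true
    hit-exists σ X Y Pσ δ<1 hit with searchSupport (λ R → intersects R X Y ≟ true) σ Pσ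
    ... | inj₁ found = found
    ... | inj₂ none = contradiction (≤-<-trans (begin
      1ℚ             ≡⟨ solve 1 (λ d → con 1ℚ := (con 1ℚ :- d) :+ d) refl δ ⟩
      (1ℚ - δ) + δ   ≤⟨ +-monoˡ-≤ δ (≤-trans hit (≤-reflexive (probHit-none σ X Y (All.map ¬-not none)))) ⟩
      0ℚ + δ         ≡⟨ +-identityˡ δ ⟩
      δ              ∎) δ<1) (<-irrefl refl)
      where open ≤-Reasoning

    below-mean : ∀ {P} σ → AllNonneg σ → totalWeight σ ≡ 1ℚ → SupportedOn P σ → 6 · δ < 1ℚ →
                 ∀ F K → 1 ℕ.≤ K → Bounded σ F (6 ℕ.* K) → Σ (Rectangle na nb) λ R → P R × F R ℕ.< K
    below-mean σ nonneg total Pσ 6δ<1 F (suc k) _ (bounded F≤) with searchSupport (λ R → F R ℕ.<? suc k) σ Pσ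
    ... | inj₁ found = found
    ... | inj₂ none = contradiction (begin-strict
      suc k · 1ℚ             ≡⟨ cong (suc k ·_) total ⟨
      suc k · totalWeight σ  ≡⟨ 𝔼-const σ (suc k) ⟨
      𝔼 σ (λ _ → suc k)      ≤⟨ 𝔼-mono-≤ nonneg (All.map ℕ.≮⇒≥ none) ⟩
      𝔼 σ F                  ≤⟨ F≤ ⟩
      (6 ℕ.* suc k) · δ      ≡⟨ cong (_· δ) (ℕ.*-comm 6 (suc k)) ⟩
      (suc k ℕ.* 6) · δ      ≡⟨ ·-assocˡ δ (suc k) 6 ⟨
      suc k · 6 · δ          <⟨ ·-monoʳ-< k 6δ<1 ⟩
      suc k · 1ℚ             ∎) (<-irrefl refl)
      where open ≤-Reasoning

    6·δ<1 : δ < ℤ.+ 1 / 6 → 6 · δ < 1ℚ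
    6·δ<1 δ<1/6 = ·-monoʳ-< 5 δ<1/6

    δ<1 : δ < ℤ.+ 1 / 6 → δ < 1ℚ
    δ<1 δ<1/6 = <-trans δ<1/6 (toWitness {a? = ℤ.+ 1 / 6 <? 1ℚ} tt)

module Arithmetic where

  open import Data.Nat
  open import Data.Nat.Properties
  open import Data.Sum using (_⊎_; inj₁; inj₂)
  open import Data.Product using (_×_; _,_)
  open import Data.Unit using (tt)
  open import Relation.Nullary using (contradiction)
  open import Relation.Binary.PropositionalEquality
  import Data.Nat.Tactic.RingSolver as Ring

  ^-distribʳ-* : ∀ a b n → (a * b) ^ n ≡ a ^ n * b ^ n
  ^-distribʳ-* a b zero = refl
  ^-distribʳ-* a b (suc n) rewrite ^-distribʳ-* a b n = interchange a b (a ^ n) (b ^ n)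
    where
    interchange : ∀ a b x y → a * b * (x * y) ≡ a * x * (b * y)
    interchange = Ring.solve-∀

  exponent-bound : ∀ y e → 2 ^ y ≤ 3 ^ e → 7 * y ≤ 12 * e
  exponent-bound y e 2^y≤3^e = ≮⇒≥ λ 12e<7y → <-irrefl refl (begin-strict
    3 ^ (12 * e)   <⟨ ^-monoʳ-< 3 (s≤s (s≤s z≤n)) 12e<7y ⟩
    3 ^ (7 * y)    ≡⟨ ^-*-assoc 3 7 y ⟨
    (3 ^ 7) ^ y    ≤⟨ ^-monoˡ-≤ y (≤ᵇ⇒≤ (3 ^ 7) (2 ^ 12) tt) ⟩
    (2 ^ 12) ^ y   ≡⟨ trans (^-*-assoc 2 12 y) (trans (cong (2 ^_) (*-comm 12 y)) (sym (^-*-assoc 2 y 12))) ⟩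
    (2 ^ y) ^ 12   ≤⟨ ^-monoˡ-≤ 12 2^y≤3^e ⟩
    (3 ^ e) ^ 12   ≡⟨ trans (^-*-assoc 3 e 12) (cong (3 ^_) (*-comm e 12)) ⟩
    3 ^ (12 * e)   ∎)
    where open ≤-Reasoning

  power-bound : ∀ εn εd h p c q → εn ≤ εd → p ^ εd ≤ 2 ^ (h * (εd ∸ εn)) →
    2 ^ (h * q) ≤ 3 ^ c * (9 * p) ^ q → 2 ^ (q * εn * h) ≤ 3 ^ ((c + 2 * q) * εd)
  power-bound εn εd h p c q εn≤εd p^εd≤ 2^hq≤ = *-cancelʳ-≤ _ _ (2 ^ D) {{m^n≢0 2 D}} (begin
    2 ^ (q * εn * h) * 2 ^ D                       ≡⟨ ^-distribˡ-+-* 2 (q * εn * h) D ⟨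
    2 ^ (q * εn * h + D)                           ≡⟨ cong (2 ^_) split ⟨
    2 ^ (h * q * εd)                               ≡⟨ ^-*-assoc 2 (h * q) εd ⟨
    (2 ^ (h * q)) ^ εd                             ≤⟨ ^-monoˡ-≤ εd 2^hq≤ ⟩
    (3 ^ c * (9 * p) ^ q) ^ εd                     ≡⟨ ^-distribʳ-* (3 ^ c) _ εd ⟩
    (3 ^ c) ^ εd * ((9 * p) ^ q) ^ εd              ≡⟨ cong₂ _*_ (^-*-assoc 3 c εd) (^-*-assoc (9 * p) q εd) ⟩
    3 ^ (c * εd) * (9 * p) ^ (q * εd)              ≡⟨ cong (3 ^ (c * εd) *_) (^-distribʳ-* 9 p (q * εd)) ⟩
    3 ^ (c * εd) * (9 ^ (q * εd) * p ^ (q * εd))   ≤⟨ *-monoʳ-≤ (3 ^ (c * εd)) (*-monoʳ-≤ (9 ^ (q * εd)) p^qεd≤) ⟩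
    3 ^ (c * εd) * (9 ^ (q * εd) * 2 ^ D)          ≡⟨ *-assoc (3 ^ (c * εd)) _ _ ⟨
    3 ^ (c * εd) * 9 ^ (q * εd) * 2 ^ D            ≡⟨ cong (λ t → 3 ^ (c * εd) * t * 2 ^ D) nine ⟩
    3 ^ (c * εd) * 3 ^ (2 * q * εd) * 2 ^ D        ≡⟨ cong (_* 2 ^ D) (^-distribˡ-+-* 3 (c * εd) _) ⟨
    3 ^ (c * εd + 2 * q * εd) * 2 ^ D              ≡⟨ cong (λ t → 3 ^ t * 2 ^ D) (*-distribʳ-+ εd c (2 * q)) ⟨
    3 ^ ((c + 2 * q) * εd) * 2 ^ D                 ∎)
    where
    open ≤-Reasoning
    D : ℕ
    D = h * (εd ∸ εn) * q
    split : h * q * εd ≡ q * εn * h + D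
    split = trans (cong (h * q *_) (sym (m+[n∸m]≡n εn≤εd))) (shuffle h q εn (εd ∸ εn))
      where
      shuffle : ∀ h q a b → h * q * (a + b) ≡ q * a * h + h * b * q
      shuffle = Ring.solve-∀
    p^qεd≤ : p ^ (q * εd) ≤ 2 ^ D
    p^qεd≤ = begin
      p ^ (q * εd)                ≡⟨ cong (p ^_) (*-comm q εd) ⟩
      p ^ (εd * q)                ≡⟨ ^-*-assoc p εd q ⟨
      (p ^ εd) ^ q                ≤⟨ ^-monoˡ-≤ q p^εd≤ ⟩
      (2 ^ (h * (εd ∸ εn))) ^ q   ≡⟨ ^-*-assoc 2 (h * (εd ∸ εn)) q ⟩
      2 ^ D                       ∎
    nine : 9 ^ (q * εd) ≡ 3 ^ (2 * q * εd)
    nine = trans (^-*-assoc 3 2 (q * εd)) (cong (3 ^_) (sym (*-assoc 2 q εd)))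

  query-depth-bound : ∀ εn εd h p c q → εn ≤ εd → 6 * εd ≤ h * εn → p ^ εd ≤ 2 ^ (h * (εd ∸ εn)) →
    2 ^ (h * q) ≤ 3 ^ c * (9 * p) ^ q → q * εn * h ≤ 4 * εd * c
  query-depth-bound εn εd h p c q εn≤εd 6εd≤hεn p^εd≤ 2^hq≤ = *-cancelˡ-≤ 3 (+-cancelʳ-≤ (4 * Y) _ _ (begin
    3 * Y + 4 * Y                         ≡⟨ *-distribʳ-+ Y 3 4 ⟨
    7 * Y                                 ≤⟨ exponent-bound Y ((c + 2 * q) * εd)
                                               (power-bound εn εd h p c q εn≤εd p^εd≤ 2^hq≤) ⟩
    12 * ((c + 2 * q) * εd)               ≡⟨ expand c q εd ⟩
    12 * εd * c + 4 * q * (6 * εd)        ≤⟨ +-monoʳ-≤ (12 * εd * c) (*-monoʳ-≤ (4 * q) 6εd≤hεn) ⟩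
    12 * εd * c + 4 * q * (h * εn)        ≡⟨ regroup εd c q h εn ⟩
    3 * (4 * εd * c) + 4 * Y              ∎))
    where
    open ≤-Reasoning
    Y : ℕ
    Y = q * εn * h
    expand : ∀ c q εd → 12 * ((c + 2 * q) * εd) ≡ 12 * εd * c + 4 * q * (6 * εd)
    expand = Ring.solve-∀
    regroup : ∀ εd c q h εn → 12 * εd * c + 4 * q * (h * εn) ≡ 3 * (4 * εd * c) + 4 * (q * εn * h)
    regroup = Ring.solve-∀

  fixed-product : ∀ LS LT s t a b → LS ≤ s + a → LT ≤ t + b → s ≤ LS →
    3 * (LT * a + LS * b) < LS * LT → 2 * (LS * LT) ≤ 3 * (s * t)
  fixed-product LS LT s t a b LS≤ LT≤ s≤LS small = +-cancelʳ-≤ (LS * LT) _ _ (≤-pred (begin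
    suc (2 * (LS * LT) + LS * LT)                ≡⟨ cong suc (thrice (LS * LT)) ⟩
    suc (3 * (LS * LT))                          ≤⟨ s≤s (*-monoʳ-≤ 3 LSLT≤) ⟩
    suc (3 * (s * t + (LT * a + LS * b)))        ≡⟨ cong suc (*-distribˡ-+ 3 (s * t) _) ⟩
    suc (3 * (s * t) + 3 * (LT * a + LS * b))    ≡⟨ +-suc (3 * (s * t)) _ ⟨
    3 * (s * t) + suc (3 * (LT * a + LS * b))    ≤⟨ +-monoʳ-≤ (3 * (s * t)) small ⟩
    3 * (s * t) + LS * LT                        ≤⟨ n≤1+n _ ⟩
    suc (3 * (s * t) + LS * LT)                  ∎))
    where
    open ≤-Reasoning
    thrice : ∀ x → 2 * x + x ≡ 3 * x
    thrice = Ring.solve-∀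
    regroup : ∀ x y a LT → x + y + a * LT ≡ x + (LT * a + y)
    regroup = Ring.solve-∀
    LSLT≤ : LS * LT ≤ s * t + (LT * a + LS * b)
    LSLT≤ = begin
      LS * LT                  ≤⟨ *-monoˡ-≤ LT LS≤ ⟩
      (s + a) * LT             ≡⟨ *-distribʳ-+ LT s a ⟩
      s * LT + a * LT          ≤⟨ +-monoˡ-≤ (a * LT) (*-monoʳ-≤ s LT≤) ⟩
      s * (t + b) + a * LT     ≡⟨ cong (_+ a * LT) (*-distribˡ-+ s t b) ⟩
      s * t + s * b + a * LT   ≤⟨ +-monoˡ-≤ (a * LT) (+-monoʳ-≤ (s * t) (*-monoˡ-≤ b s≤LS)) ⟩
      s * t + LS * b + a * LT  ≡⟨ regroup (s * t) (LS * b) a LT ⟩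
      s * t + (LT * a + LS * b) ∎

  triggered-product : ∀ K P Ss Tt LS LT → (K * Ss ≤ P * LS × Tt ≤ LT) ⊎ (K * Tt ≤ P * LT × Ss ≤ LS) →
    K * (Ss * Tt) ≤ P * (LS * LT)
  triggered-product K P Ss Tt LS LT (inj₁ (KSs≤ , Tt≤)) = begin
    K * (Ss * Tt)   ≡⟨ *-assoc K Ss Tt ⟨
    K * Ss * Tt     ≤⟨ *-mono-≤ KSs≤ Tt≤ ⟩
    P * LS * LT     ≡⟨ *-assoc P LS LT ⟩
    P * (LS * LT)   ∎
    where open ≤-Reasoning
  triggered-product K P Ss Tt LS LT (inj₂ (KTt≤ , Ss≤)) = begin
    K * (Ss * Tt)   ≡⟨ swap K Ss Tt ⟩
    Ss * (K * Tt)   ≤⟨ *-mono-≤ Ss≤ KTt≤ ⟩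
    LS * (P * LT)   ≡⟨ swap LS P LT ⟩
    P * (LS * LT)   ∎
    where
    open ≤-Reasoning
    swap : ∀ a b c → a * (b * c) ≡ b * (a * c)
    swap = Ring.solve-∀

  density-after-fix : ∀ h p q A X Ss Tt LS LT s t → X * 2 ^ (h * q) ≤ A * (9 * p) ^ q * (Ss * Tt) →
    2 ^ h * (Ss * Tt) ≤ 6 * p * (LS * LT) → 2 * (LS * LT) ≤ 3 * (s * t) →
    X * 2 ^ (h * suc q) ≤ A * (9 * p) ^ suc q * (s * t)
  density-after-fix h p q A X Ss Tt LS LT s t density triggered fixed = begin
    X * 2 ^ (h * suc q)                        ≡⟨ cong (λ e → X * 2 ^ e) (*-suc h q) ⟩
    X * 2 ^ (h + h * q)                        ≡⟨ cong (X *_) (^-distribˡ-+-* 2 h (h * q)) ⟩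
    X * (2 ^ h * 2 ^ (h * q))                  ≡⟨ shuffle₁ X (2 ^ h) (2 ^ (h * q)) ⟩
    X * 2 ^ (h * q) * 2 ^ h                    ≤⟨ *-monoˡ-≤ (2 ^ h) density ⟩
    A * (9 * p) ^ q * (Ss * Tt) * 2 ^ h        ≡⟨ shuffle₂ (A * (9 * p) ^ q) (Ss * Tt) (2 ^ h) ⟩
    A * (9 * p) ^ q * (2 ^ h * (Ss * Tt))      ≤⟨ *-monoʳ-≤ (A * (9 * p) ^ q) triggered ⟩
    A * (9 * p) ^ q * (6 * p * (LS * LT))      ≡⟨ shuffle₃ (A * (9 * p) ^ q) p (LS * LT) ⟩
    A * (9 * p) ^ q * (3 * p) * (2 * (LS * LT)) ≤⟨ *-monoʳ-≤ (A * (9 * p) ^ q * (3 * p)) fixed ⟩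
    A * (9 * p) ^ q * (3 * p) * (3 * (s * t))  ≡⟨ shuffle₄ A ((9 * p) ^ q) p (s * t) ⟩
    A * ((9 * p) * (9 * p) ^ q) * (s * t)      ∎
    where
    open ≤-Reasoning
    shuffle₁ : ∀ a b c → a * (b * c) ≡ a * c * b
    shuffle₁ = Ring.solve-∀
    shuffle₂ : ∀ a b c → a * b * c ≡ a * (c * b)
    shuffle₂ = Ring.solve-∀
    shuffle₃ : ∀ a p x → a * (6 * p * x) ≡ a * (3 * p) * (2 * x)
    shuffle₃ = Ring.solve-∀
    shuffle₄ : ∀ a b p x → a * b * (3 * p) * (3 * x) ≡ a * (9 * p * b) * x
    shuffle₄ = Ring.solve-∀

  positive-factors : ∀ a s t → 1 ≤ a * (s * t) → 1 ≤ s × 1 ≤ t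
  positive-factors a zero t 1≤ = contradiction (subst (1 ≤_) (*-zeroʳ a) 1≤) λ ()
  positive-factors a (suc s) zero 1≤ =
    contradiction (subst (1 ≤_) (trans (cong (a *_) (*-zeroʳ (suc s))) (*-zeroʳ a)) 1≤) λ ()
  positive-factors a (suc s) (suc t) _ = s≤s z≤n , s≤s z≤n

  density-after-messageˡ : ∀ X c B s s″ t → X ≤ 3 ^ c * B * (s * t) → s ≤ 3 * s″ → X ≤ 3 ^ suc c * B * (s″ * t)
  density-after-messageˡ X c B s s″ t density s≤ =
    ≤-trans density (≤-trans (*-monoʳ-≤ (3 ^ c * B) (*-monoˡ-≤ t s≤)) (≤-reflexive (shuffle (3 ^ c) B s″ t)))
    where
    shuffle : ∀ a B s t → a * B * (3 * s * t) ≡ 3 * a * B * (s * t)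
    shuffle = Ring.solve-∀

  density-after-messageʳ : ∀ X c B s t t″ → X ≤ 3 ^ c * B * (s * t) → t ≤ 3 * t″ → X ≤ 3 ^ suc c * B * (s * t″)
  density-after-messageʳ X c B s t t″ density t≤ =
    ≤-trans density (≤-trans (*-monoʳ-≤ (3 ^ c * B) (*-monoʳ-≤ s t≤)) (≤-reflexive (shuffle (3 ^ c) B s t″)))
    where
    shuffle : ∀ a B s t → a * B * (s * (3 * t)) ≡ 3 * a * B * (s * t)
    shuffle = Ring.solve-∀

open import Defs
open import Data.Bool using (Bool)
open import Data.Nat using (ℕ; _≤_; _<_; _*_; _^_; _∸_)
open import Data.Fin using (Fin)
open import Data.Vec using (Vec)
open import Data.Product using (Σ; _×_)
open import Data.Integer using (+_)
open import Data.Rational using (ℚ; 0ℚ) renaming (_<_ to _<ℚ_; _/_ to _/ℚ_)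

module HittingGadget {N M : ℕ} (g : PartialFun N M) (δ : ℚ) (δ<1/6 : δ <ℚ (+ 1 /ℚ 6)) (h : ℕ)
  (σ : Bool → RectDist N M) (σ-hitting : ∀ c → IsHitting δ h (σ c))
  (σ-mono : ∀ c → SupportedOn (Monochromatic g c) (σ c)) where

  open import Data.Bool using (true; false; _∧_; not)
  open import Data.Bool.Properties using (∧-zeroʳ)
  open import Data.Nat using (zero; suc; _+_; _*_; _^_; _≤_; _<_; z≤n; s≤s)
  open import Data.Nat.Properties using (m≤n*m; m^n≢0; ≤-trans; +-monoʳ-≤)
  open import Data.Fin using (Fin; _≟_)
  open import Data.Fin.Subset using (Subset; ∣_∣; ⊤)
  open import Data.Fin.Subset.Properties using (∣⊤∣≡n)
  open import Data.List using (List; []; _∷_; allFin)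
  open import Data.List.Membership.Propositional using (_∈_)
  open import Data.List.Membership.Propositional.Properties using (∈-allFin)
  open import Data.List.Relation.Unary.Any using (here; there)
  open import Data.Vec using (Vec; lookup; _[_]≔_)
  open import Data.Vec.Properties using (lookup⇒[]=; lookup∘tabulate; lookup∘updateAt; lookup∘updateAt′)
  open import Data.Maybe using (just)
  open import Data.Product using (Σ; ∃₂; _×_; _,_)
  open import Function using (case_of_)
  open import Relation.Nullary using (yes; no; contradiction)
  open import Relation.Binary.PropositionalEquality
  import Data.Nat.Tactic.RingSolver as Ring
  open import Defs using (Rectangle; intersects)
  open Sums using (𝟙)
  open Search using (∧-true₁; ∧-true₂)
  open CubeSets
  open Thickness using (Thick; cylinder-thick; thick-on-cylinder)
  open Restriction using (meets; meets⁻; restricted; size-cylinder≤)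
  open Expectation {N} {M}

  dense-⊤ : ∀ n → n ≤ 2 ^ h * ∣ ⊤ {n} ∣
  dense-⊤ n = subst (λ k → n ≤ 2 ^ h * k) (sym (∣⊤∣≡n n)) (m≤n*m n (2 ^ h) {{m^n≢0 2 h}})

  hitting-pair : ∀ c (X : Subset N) (Y : Subset M) → N ≤ 2 ^ h * ∣ X ∣ → M ≤ 2 ^ h * ∣ Y ∣ →
    ∃₂ λ a b → lookup X a ≡ true × lookup Y b ≡ true × g a b ≡ just c
  hitting-pair c X Y denseX denseY =
    let (_ , hits) = σ-hitting c
        ((U , V) , mono , hit) = hit-exists δ (σ c) X Y (σ-mono c) (δ<1 δ δ<1/6) (hits X Y denseX denseY)
        (a , a∈U , a∈X) = meets⁻ U X (∧-true₁ hit)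
        (b , b∈V , b∈Y) = meets⁻ V Y (∧-true₂ {meets U X} hit)
    in a , b , a∈X , b∈Y , mono a b (lookup⇒[]= a U a∈U) (lookup⇒[]= b V b∈V)

  N≥1 : 1 ≤ N
  N≥1 with hitting-pair true ⊤ ⊤ (dense-⊤ N) (dense-⊤ M)
  ... | Fin.zero , _ = s≤s z≤n
  ... | Fin.suc _ , _ = s≤s z≤n

  M≥1 : 1 ≤ M
  M≥1 with hitting-pair true ⊤ ⊤ (dense-⊤ N) (dense-⊤ M)
  ... | _ , Fin.zero , _ = s≤s z≤n
  ... | _ , Fin.suc _ , _ = s≤s z≤n

  missesS : ∀ {p} → Fin p → CubeSet {N} {p} → Rectangle N M → ℕ
  missesS j S R = size (λ x → cylinder j S x ∧ not (intersects R (fibre j S x) ⊤))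

  missesT : ∀ {p} → Fin p → CubeSet {M} {p} → Rectangle N M → ℕ
  missesT j T R = size (λ y → cylinder j T y ∧ not (intersects R ⊤ (fibre j T y)))

  size-cylinder≤-missesS : ∀ {p} j (S : CubeSet {N} {p}) U V →
    size (cylinder j S) ≤ size (restricted j S U) + missesS j S (U , V)
  size-cylinder≤-missesS j S U V =
    ≤-trans (size-cylinder≤ j S U) (+-monoʳ-≤ (size (restricted j S U)) (size-mono λ x → miss x))
    where
    miss : ∀ x → (cylinder j S x ∧ not (restricted j S U x)) ≡ true →
           (cylinder j S x ∧ not (intersects (U , V) (fibre j S x) ⊤)) ≡ true
    miss x e with cylinder j S x | restricted j S U x
    ... | true | false = refl

  size-cylinder≤-missesT : ∀ {p} j (T : CubeSet {M} {p}) U V →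
    size (cylinder j T) ≤ size (restricted j T V) + missesT j T (U , V)
  size-cylinder≤-missesT j T U V =
    ≤-trans (size-cylinder≤ j T V) (+-monoʳ-≤ (size (restricted j T V)) (size-mono λ y → miss y))
    where
    miss : ∀ y → (cylinder j T y ∧ not (restricted j T V y)) ≡ true →
           (cylinder j T y ∧ not (intersects (U , V) ⊤ (fibre j T y))) ≡ true
    miss y e with cylinder j T y | restricted j T V y
    ... | true | false = cong not (∧-zeroʳ (meets U ⊤))

  module _ {p : ℕ} (free : Fin p → Bool) where

    Realizes : Vec (Fin N) p → Vec (Fin M) p → Vec Bool p → List (Fin p) → Set
    Realizes x y w L = ∀ i → i ∈ L → free i ≡ true → g (lookup x i) (lookup y i) ≡ just (lookup w i)

    -- Passing to the cylinders along j keeps the other coordinates thick; coordinate j is then set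
    -- by a hitting pair inside the two fibres.
    realize : ∀ (S : CubeSet {N} {p}) (T : CubeSet {M} {p}) → Thick h free S → Thick h free T →
      Σ (Vec (Fin N) p) (λ x → S x ≡ true) → Σ (Vec (Fin M) p) (λ y → T y ≡ true) → ∀ w L →
      Σ (Vec (Fin N) p) λ x → Σ (Vec (Fin M) p) λ y → S x ≡ true × T y ≡ true × Realizes x y w L
    realize S T thickS thickT (x , x∈S) (y , y∈T) w [] = x , y , x∈S , y∈T , λ i ()
    realize S T thickS thickT (x₀ , x∈S) (y₀ , y∈T) w (j ∷ L) with free j in free-j
    ... | false =
      let (x , y , x∈S , y∈T , realizes) = realize S T thickS thickT (x₀ , x∈S) (y₀ , y∈T) w L
      in x , y , x∈S , y∈T , λ
        { i (here refl) free-i → contradiction (trans (sym free-j) free-i) λ ()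
        ; i (there i∈L) → realizes i i∈L }
    ... | true =
      let (x , y , x∈C , y∈C , realizes) =
            realize (cylinder j S) (cylinder j T) (cylinder-thick h free j S thickS) (cylinder-thick h free j T thickT)
                    (x₀ , ⊆-cylinder j S x₀ x∈S) (y₀ , ⊆-cylinder j T y₀ y∈T) w L
          (a , b , a∈F , b∈F , gab) = hitting-pair (lookup w j) (fibre j S x) (fibre j T y)
                    (thick-on-cylinder h free j x thickS free-j x∈C) (thick-on-cylinder h free j y thickT free-j y∈C)
          at-j : g (lookup (x [ j ]≔ a) j) (lookup (y [ j ]≔ b) j) ≡ just (lookup w j)
          at-j = trans (cong₂ g (lookup∘updateAt j x) (lookup∘updateAt j y)) gab
          realizes′ : Realizes (x [ j ]≔ a) (y [ j ]≔ b) w (j ∷ L)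
          realizes′ = λ
            { i (here refl) _ → at-j
            ; i (there i∈L) free-i → case i ≟ j of λ
                { (yes refl) → at-j
                ; (no i≢j) → trans (cong₂ g (lookup∘updateAt′ i j i≢j x) (lookup∘updateAt′ i j i≢j y))
                                   (realizes i i∈L free-i) } }
      in x [ j ]≔ a , y [ j ]≔ b , trans (sym (lookup∘tabulate _ a)) a∈F , trans (sym (lookup∘tabulate _ b)) b∈F , realizes′

    thick-realizes : ∀ (S : CubeSet {N} {p}) (T : CubeSet {M} {p}) → Thick h free S → Thick h free T →
      Σ (Vec (Fin N) p) (λ x → S x ≡ true) → Σ (Vec (Fin M) p) (λ y → T y ≡ true) → ∀ w →
      Σ (Vec (Fin N) p) λ x → Σ (Vec (Fin M) p) λ y →
        S x ≡ true × T y ≡ true × (∀ i → free i ≡ true → g (lookup x i) (lookup y i) ≡ just (lookup w i))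
    thick-realizes S T thickS thickT x∈S y∈T w =
      let (x , y , x∈S , y∈T , realizes) = realize S T thickS thickT x∈S y∈T w (allFin p)
      in x , y , x∈S , y∈T , λ i → realizes i (∈-allFin i)

    missesS-bounded : ∀ {S} j → Thick h free S → free j ≡ true → ∀ c → Bounded δ (σ c) (missesS j S) (size (cylinder j S))
    missesS-bounded {S} j thick free-j c = Bounded-∑ᶜ δ (σ c) p miss
      where
      miss : ∀ x → Bounded δ (σ c) (λ R → 𝟙 (cylinder j S x ∧ not (intersects R (fibre j S x) ⊤))) (𝟙 (cylinder j S x))
      miss x with cylinder j S x in x∈C
      ... | false = Bounded-zero δ (σ c)
      ... | true = let ((_ , total) , hits) = σ-hitting c in
        miss-bounded δ (σ c) _ ⊤ total (hits _ ⊤ (thick-on-cylinder h free j x thick free-j x∈C) (dense-⊤ M))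

    missesT-bounded : ∀ {T} j → Thick h free T → free j ≡ true → ∀ c → Bounded δ (σ c) (missesT j T) (size (cylinder j T))
    missesT-bounded {T} j thick free-j c = Bounded-∑ᶜ δ (σ c) p miss
      where
      miss : ∀ y → Bounded δ (σ c) (λ R → 𝟙 (cylinder j T y ∧ not (intersects R ⊤ (fibre j T y)))) (𝟙 (cylinder j T y))
      miss y with cylinder j T y in y∈C
      ... | false = Bounded-zero δ (σ c)
      ... | true = let ((_ , total) , hits) = σ-hitting c in
        miss-bounded δ (σ c) ⊤ _ total (hits ⊤ _ (dense-⊤ N) (thick-on-cylinder h free j y thick free-j y∈C))

    -- Each point of a cylinder misses a rectangle of σ c with probability at most δ, so the
    -- weighted miss count has mean at most 6δ·LS·LT < LS·LT.
    good-rectangle : ∀ {S T} j → Thick h free S → Thick h free T → free j ≡ true →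
      let LS = size (cylinder j S) ; LT = size (cylinder j T) in
      1 ≤ LS * LT → ∀ c →
      Σ (Rectangle N M) λ R → Monochromatic g c R × 3 * (LT * missesS j S R + LS * missesT j T R) < LS * LT
    good-rectangle {S} {T} j thickS thickT free-j 1≤LSLT c =
      let ((nonneg , total) , _) = σ-hitting c
      in below-mean δ (σ c) nonneg total (σ-mono c) (6·δ<1 δ δ<1/6) _ (LS * LT) 1≤LSLT
           (subst (Bounded δ (σ c) _) (six LS LT)
             (Bounded-* δ (σ c) 3 (Bounded-+ δ (σ c) (Bounded-* δ (σ c) LT (missesS-bounded j thickS free-j c))
                                                    (Bounded-* δ (σ c) LS (missesT-bounded j thickT free-j c)))))
      where
      LS LT : ℕ
      LS = size (cylinder j S)
      LT = size (cylinder j T)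
      six : ∀ a b → 3 * (b * a + a * b) ≡ 6 * (a * b)
      six = Ring.solve-∀

module Simulation {N M : ℕ} (g : PartialFun N M) (δ : ℚ) (δ<1/6 : δ <ℚ (+ 1 /ℚ 6)) (h : ℕ)
  (σ : Bool → RectDist N M) (σ-hitting : ∀ c → IsHitting δ h (σ c))
  (σ-mono : ∀ c → SupportedOn (Monochromatic g c) (σ c))
  {p : ℕ} (1≤p : 1 ≤ p) {Z : Set} (f : Vec Bool p → Z)
  (P₀ : Protocol (Vec (Fin N) p) (Vec (Fin M) p) Z) (P₀-ok : ProtocolComputes P₀ (compose f g)) where

  open import Data.Bool using (true; false; if_then_else_)
  open import Data.Bool.Properties using (∧-identityʳ) renaming (_≟_ to _≟ᵇ_)
  open import Data.Nat using (suc; _+_; _*_; _^_; _<_; _<?_; _⊔_; s≤s; >-nonZero)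
  open import Data.Nat.Properties hiding (_≟_)
  open import Data.Nat.Induction using (<-wellFounded)
  open import Data.Fin as Fin using (_≟_)
  open import Data.Fin.Properties using (any?)
  open import Data.Fin.Subset using (∣_∣)
  open import Data.Vec using ([]; _∷_; lookup)
  open import Data.Vec.Properties using (lookup⇒[]=)
  open import Data.Maybe using (just)
  open import Data.Product using (Σ; _×_; _,_; proj₁; proj₂)
  open import Data.Sum using (_⊎_; inj₁; inj₂)
  open import Function using (id; _∘_)
  open import Induction.WellFounded using (Acc; acc)
  open import Relation.Nullary using (Dec; ¬_; yes; no; does; _×-dec_; _⊎-dec_)
  open import Relation.Nullary.Decidable using (dec-true)
  open import Relation.Binary.PropositionalEquality
  open Sums
  open Search using (∧-true₁)
  open Lines
  open CubeSets
  open Thickness using (Thick; Spread; splitThick)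
  open Restriction using (restricted; relabel; relabel-keepsFree; relabel-restricted; restricted-thick; restricted-⊆)
  open Arithmetic
    using (positive-factors; triggered-product; fixed-product; density-after-fix; density-after-messageˡ; density-after-messageʳ)
  open HittingGadget g δ δ<1/6 h σ σ-hitting σ-mono

  VA VB Prot : Set
  VA = Vec (Fin N) p
  VB = Vec (Fin M) p
  Prot = Protocol VA VB Z

  D : ℕ
  D = depthP P₀

  -- The tree node sits on the rectangle S × T; ρA and ρB map its points to inputs of P₀ (they
  -- differ only in fixed coordinates), fixed holds the answers to the q queries made so far,
  -- and c bits have been communicated.
  record State : Set where
    constructor state
    field
      free fixed : Fin p → Bool
      S : CubeSet {N} {p}
      T : CubeSet {M} {p}
      ρA : VA → VA
      ρB : VB → VB
      c q : ℕ

  record Invariant (P : Prot) (st : State) : Set where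
    open State st
    field
      ρA-keeps : KeepsFree free ρA
      ρB-keeps : KeepsFree free ρB
      fixed-ok : ∀ x y i → S x ≡ true → T y ≡ true → free i ≡ false →
                 g (lookup (ρA x) i) (lookup (ρB y) i) ≡ just (fixed i)
      run-ok : ∀ x y → S x ≡ true → T y ≡ true → runP P₀ (ρA x) (ρB y) ≡ runP P (ρA x) (ρB y)
      thickS : Thick h free S
      thickT : Thick h free T
      budget : c + depthP P ≤ D
      density : N ^ p * M ^ p * 2 ^ (h * q) ≤ 3 ^ c * (9 * p) ^ q * (size S * size T)

  Consistent : (Fin p → Bool) → (Fin p → Bool) → Vec Bool p → Set
  Consistent free fixed w = ∀ i → free i ≡ false → lookup w i ≡ fixed i

  Affordable : ℕ → Set
  Affordable d = 2 ^ (h * d) ≤ 3 ^ D * (9 * p) ^ d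

  Result : State → Set
  Result st = Σ (DecTree p Z) λ T → (∀ w → Consistent free fixed w → evalT T w ≡ f w) × Affordable (depthT T + q)
    where open State st

  Balanced : State → Set
  Balanced st = Spread h free S × Spread h free T
    where open State st

  Continue : Prot → Set
  Continue P = ∀ st → Invariant P st → Balanced st → Result st

  gPow-just : ∀ {k} (x : Vec (Fin N) k) (y : Vec (Fin M) k) (w : Vec Bool k) →
    (∀ i → g (lookup x i) (lookup y i) ≡ just (lookup w i)) → gPow g x y ≡ just w
  gPow-just [] [] [] agree = refl
  gPow-just (a ∷ x) (b ∷ y) (c ∷ w) agree
    with g a b | agree Fin.zero | gPow g x y | gPow-just x y w (λ i → agree (Fin.suc i))
  ... | just .c | refl | just .w | refl = refl

  compose-just : ∀ x y w → gPow g x y ≡ just w → compose f g x y ≡ just (f w)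
  compose-just x y w gPow≡ with gPow g x y | gPow≡
  ... | just .w | refl = refl

  NM≥1 : 1 ≤ N ^ p * M ^ p
  NM≥1 = *-mono-≤ (subst (_≤ N ^ p) (^-zeroˡ p) (^-monoˡ-≤ p N≥1)) (subst (_≤ M ^ p) (^-zeroˡ p) (^-monoˡ-≤ p M≥1))

  sizes-positive : ∀ {P st} → Invariant P st → 1 ≤ size (State.S st) × 1 ≤ size (State.T st)
  sizes-positive {P} {st} inv = positive-factors (3 ^ c * (9 * p) ^ q) (size S) (size T)
    (≤-trans (*-mono-≤ NM≥1 (m^n>0 2 (h * q))) (Invariant.density inv))
    where
    open State st

  leaf-correct : ∀ z st → Invariant (output z) st → ∀ w → Consistent (State.free st) (State.fixed st) w → z ≡ f w
  leaf-correct z st inv w consistent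
    with thick-realizes free S T thickS thickT (nonempty S (proj₁ (sizes-positive inv)))
                                               (nonempty T (proj₂ (sizes-positive inv))) w
    where
    open State st
    open Invariant inv
  ... | x , y , x∈S , y∈T , realizes =
    trans (sym (run-ok x y x∈S y∈T))
          (P₀-ok (ρA x) (ρB y) (f w) (compose-just (ρA x) (ρB y) w (gPow-just (ρA x) (ρB y) w agree)))
    where
    open State st
    open Invariant inv
    agree : ∀ i → g (lookup (ρA x) i) (lookup (ρB y) i) ≡ just (lookup w i)
    agree i with free i in free-i
    ... | true = trans (cong₂ g (ρA-keeps x i free-i) (ρB-keeps y i free-i)) (realizes i free-i)
    ... | false = trans (fixed-ok x y i x∈S y∈T free-i) (cong just (sym (consistent i free-i)))

  leaf-affordable : ∀ {P} st → Invariant P st → Affordable (State.q st)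
  leaf-affordable {P} st inv = *-cancelʳ-≤ _ _ (N ^ p * M ^ p) {{>-nonZero NM≥1}} (begin
    2 ^ (h * q) * (N ^ p * M ^ p)                  ≡⟨ *-comm _ (N ^ p * M ^ p) ⟩
    N ^ p * M ^ p * 2 ^ (h * q)                    ≤⟨ density ⟩
    3 ^ c * (9 * p) ^ q * (size S * size T)        ≤⟨ *-mono-≤ (*-monoˡ-≤ ((9 * p) ^ q) 3^c≤3^D)
                                                               (*-mono-≤ (size≤ S) (size≤ T)) ⟩
    3 ^ D * (9 * p) ^ q * (N ^ p * M ^ p)          ∎)
    where
    open ≤-Reasoning
    open State st
    open Invariant inv
    3^c≤3^D : 3 ^ c ≤ 3 ^ D
    3^c≤3^D = ^-monoʳ-≤ 3 (≤-trans (m≤m+n c (depthP P)) budget)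

  Triggered : State → Fin p → Set
  Triggered st j = 2 ^ h * size S < 6 * p * size (cylinder j S) ⊎ 2 ^ h * size T < 6 * p * size (cylinder j T)
    where open State st

  assign : (Fin p → Bool) → Fin p → Bool → Fin p → Bool
  assign fixed j b i = if does (i ≟ j) then b else fixed i

  afterQuery : State → Fin p → Bool → Rectangle N M → State
  afterQuery st j b (U , V) =
    state (free without j) (assign fixed j b) (restricted j S U) (restricted j T V)
          (relabel j S U ρA) (relabel j T V ρB) c (suc q)
    where open State st

  afterQuery-invariant : ∀ {P} st j b R → Invariant P st → State.free st j ≡ true → Triggered st j →
    Monochromatic g b R →
    let open State st ; LS = size (cylinder j S) ; LT = size (cylinder j T) in
    3 * (LT * missesS j S R + LS * missesT j T R) < LS * LT → Invariant P (afterQuery st j b R)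
  afterQuery-invariant {P} st j b (U , V) inv free-j triggered mono good = record
    { ρA-keeps = relabel-keepsFree j S U free ρA ρA-keeps
    ; ρB-keeps = relabel-keepsFree j T V free ρB ρB-keeps
    ; fixed-ok = fixed-ok′
    ; run-ok = run-ok′
    ; thickS = restricted-thick j S U h free thickS
    ; thickT = restricted-thick j T V h free thickT
    ; budget = budget
    ; density = density-after-fix h p q (3 ^ c) (N ^ p * M ^ p) (size S) (size T) LS LT (size S′) (size T′) density
        (triggered-product (2 ^ h) (6 * p) (size S) (size T) LS LT (widen triggered))
        (fixed-product LS LT (size S′) (size T′) _ _
          (size-cylinder≤-missesS j S U V) (size-cylinder≤-missesT j T U V) (size-mono (restricted-⊆ j S U)) good)
    }
    where
    open State st
    open Invariant inv
    LS LT : ℕ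
    LS = size (cylinder j S)
    LT = size (cylinder j T)
    S′ : CubeSet {N} {p}
    S′ = restricted j S U
    T′ : CubeSet {M} {p}
    T′ = restricted j T V
    widen : Triggered st j → (2 ^ h * size S ≤ 6 * p * LS × size T ≤ LT) ⊎ (2 ^ h * size T ≤ 6 * p * LT × size S ≤ LS)
    widen (inj₁ trig) = inj₁ (<⇒≤ trig , size-mono (⊆-cylinder j T))
    widen (inj₂ trig) = inj₂ (<⇒≤ trig , size-mono (⊆-cylinder j S))
    fixed-ok′ : ∀ x y i → S′ x ≡ true → T′ y ≡ true → (free without j) i ≡ false →
                g (lookup (relabel j S U ρA x) i) (lookup (relabel j T V ρB y) i) ≡ just (assign fixed j b i)
    fixed-ok′ x y i x∈S′ y∈T′ fi
      with relabel-restricted j S U free ρA ρA-keeps free-j x x∈S′ | relabel-restricted j T V free ρB ρB-keeps free-j y y∈T′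
    ... | a , ρx≡ , a∈U , xa∈S , x_j≡a | b′ , ρy≡ , b′∈V , yb∈T , y_j≡b′ with i ≟ j
    ...   | yes refl = trans (cong₂ g x_j≡a y_j≡b′) (mono a b′ (lookup⇒[]= a U a∈U) (lookup⇒[]= b′ V b′∈V))
    ...   | no _ = trans (cong₂ (λ x′ y′ → g (lookup x′ i) (lookup y′ i)) ρx≡ ρy≡)
                         (fixed-ok _ _ i xa∈S yb∈T (trans (sym (∧-identityʳ (free i))) fi))
    run-ok′ : ∀ x y → S′ x ≡ true → T′ y ≡ true →
              runP P₀ (relabel j S U ρA x) (relabel j T V ρB y) ≡ runP P (relabel j S U ρA x) (relabel j T V ρB y)
    run-ok′ x y x∈S′ y∈T′
      with relabel-restricted j S U free ρA ρA-keeps free-j x x∈S′ | relabel-restricted j T V free ρB ρB-keeps free-j y y∈T′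
    ... | a , ρx≡ , _ , xa∈S , _ | b′ , ρy≡ , _ , yb∈T , _ rewrite ρx≡ | ρy≡ = run-ok _ _ xa∈S yb∈T

  countFree : (Fin p → Bool) → ℕ
  countFree free = ∑ p (λ i → 𝟙 (free i))

  countFree-without : ∀ free j → free j ≡ true → countFree (free without j) < countFree free
  countFree-without free j free-j =
    subst (_≤ countFree free) (+-comm (countFree (free without j)) 1) (∑-mono-≤-gap p 1 j term term-j)
    where
    term : ∀ i → 𝟙 ((free without j) i) ≤ 𝟙 (free i)
    term i = 𝟙-mono ∧-true₁
    term-j : 𝟙 ((free without j) j) + 1 ≤ 𝟙 (free j)
    term-j rewrite dec-true (j ≟ j) refl | free-j = ≤-refl

  consistent-assign : ∀ {free fixed} w j b → Consistent free fixed w → lookup w j ≡ b →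
                      Consistent (free without j) (assign fixed j b) w
  consistent-assign {free} w j b consistent w_j≡b i fi with i ≟ j
  ... | yes refl = w_j≡b
  ... | no _ = consistent i (trans (sym (∧-identityʳ (free i))) fi)

  affordable-query : ∀ d₀ d₁ q → Affordable (d₀ + suc q) → Affordable (d₁ + suc q) → Affordable (suc (d₀ ⊔ d₁) + q)
  affordable-query d₀ d₁ q aff₀ aff₁ = subst Affordable (+-suc (d₀ ⊔ d₁) q) (larger (⊔-sel d₀ d₁))
    where
    larger : d₀ ⊔ d₁ ≡ d₀ ⊎ d₀ ⊔ d₁ ≡ d₁ → Affordable (d₀ ⊔ d₁ + suc q)
    larger (inj₁ max≡d₀) = subst (λ d → Affordable (d + suc q)) (sym max≡d₀) aff₀
    larger (inj₂ max≡d₁) = subst (λ d → Affordable (d + suc q)) (sym max≡d₁) aff₁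

  triggered? : ∀ st j → Dec (State.free st j ≡ true × Triggered st j)
  triggered? st j = (free j ≟ᵇ true) ×-dec ( (2 ^ h * size S <? 6 * p * size (cylinder j S))
                                           ⊎-dec (2 ^ h * size T <? 6 * p * size (cylinder j T)))
    where open State st

  balanced : ∀ st → (∀ j → ¬ (State.free st j ≡ true × Triggered st j)) → Balanced st
  balanced st untriggered =
    (λ j free-j → ≮⇒≥ λ trig → untriggered j (free-j , inj₁ trig)) ,
    (λ j free-j → ≮⇒≥ λ trig → untriggered j (free-j , inj₂ trig))

  combine : ∀ st j R₀ R₁ → Result (afterQuery st j false R₀) → Result (afterQuery st j true R₁) → Result st
  combine st j R₀ R₁ (T₀ , correct₀ , affordable₀) (T₁ , correct₁ , affordable₁) =
    query j T₀ T₁ , correct , affordable-query (depthT T₀) (depthT T₁) q affordable₀ affordable₁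
    where
    open State st
    correct : ∀ w → Consistent free fixed w → evalT (query j T₀ T₁) w ≡ f w
    correct w consistent with lookup w j in w_j
    ... | true = correct₁ w (consistent-assign w j true consistent w_j)
    ... | false = correct₀ w (consistent-assign w j false consistent w_j)

  repair : ∀ {P} st → Invariant P st → Continue P → Result st
  repair {P} st inv continue = go st inv (<-wellFounded _)
    where
    go : ∀ st → Invariant P st → Acc _<_ (countFree (State.free st)) → Result st
    go st inv (acc smaller) with any? (triggered? st)
    ... | no none = continue st inv (balanced st λ j → none ∘ (j ,_))
    ... | yes (j , free-j , triggered)
      with good-rectangle free j thickS thickT free-j cylinders-nonempty false
         | good-rectangle free j thickS thickT free-j cylinders-nonempty true
      where
      open State st
      open Invariant inv
      cylinders-nonempty : 1 ≤ size (cylinder j S) * size (cylinder j T)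
      cylinders-nonempty = *-mono-≤ (≤-trans (proj₁ (sizes-positive inv)) (size-mono (⊆-cylinder j S)))
                                    (≤-trans (proj₂ (sizes-positive inv)) (size-mono (⊆-cylinder j T)))
    ...   | R₀ , mono₀ , good₀ | R₁ , mono₁ , good₁ = combine st j R₀ R₁
      (go _ (afterQuery-invariant st j false R₀ inv free-j triggered mono₀ good₀) (smaller fewer-free))
      (go _ (afterQuery-invariant st j true R₁ inv free-j triggered mono₁ good₁) (smaller fewer-free))
      where
      fewer-free : countFree (State.free st without j) < countFree (State.free st)
      fewer-free = countFree-without (State.free st) j free-j

  branch : Bool → Prot → Prot → Prot
  branch b Q₀ Q₁ = if b then Q₁ else Q₀

  continue-branch : ∀ {Q₀ Q₁} → Continue Q₀ → Continue Q₁ → ∀ b → Continue (branch b Q₀ Q₁)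
  continue-branch k₀ k₁ false = k₀
  continue-branch k₀ k₁ true = k₁

  budget-branch : ∀ c b Q₀ Q₁ → c + suc (depthP Q₀ ⊔ depthP Q₁) ≤ D → suc c + depthP (branch b Q₀ Q₁) ≤ D
  budget-branch c b Q₀ Q₁ budget = ≤-trans (≤-trans (≤-reflexive (sym (+-suc c _))) (+-monoʳ-≤ c (s≤s (depth≤ b)))) budget
    where
    depth≤ : ∀ b → depthP (branch b Q₀ Q₁) ≤ depthP Q₀ ⊔ depthP Q₁
    depth≤ false = m≤m⊔n _ _
    depth≤ true = m≤n⊔m _ _

  run-alice : ∀ m Q₀ Q₁ b x y → m x ≡ b → runP (alice m Q₀ Q₁) x y ≡ runP (branch b Q₀ Q₁) x y
  run-alice m Q₀ Q₁ b x y m≡b rewrite m≡b with b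
  ... | false = refl
  ... | true = refl

  run-bob : ∀ m Q₀ Q₁ b x y → m y ≡ b → runP (bob m Q₀ Q₁) x y ≡ runP (branch b Q₀ Q₁) x y
  run-bob m Q₀ Q₁ b x y m≡b rewrite m≡b with b
  ... | false = refl
  ... | true = refl

  aliceSpeaks : ∀ m Q₀ Q₁ → Continue Q₀ → Continue Q₁ → Continue (alice m Q₀ Q₁)
  aliceSpeaks m Q₀ Q₁ k₀ k₁ st inv (spreadS , _) = speak (splitThick h free 1≤p S spreadS msg)
    where
    open State st
    open Invariant inv
    msg : CubeSet
    msg x = m (ρA x)
    speak : Σ Bool (λ b → Σ CubeSet λ S″ → S″ ⊆ (S ∩ msg ⁻¹ b) × Thick h free S″ × size S ≤ 3 * size S″) → Result st
    speak (b , S″ , S″⊆ , thick″ , S≤3S″) = repair (record st { S = S″ ; c = suc c }) (record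
      { ρA-keeps = ρA-keeps
      ; ρB-keeps = ρB-keeps
      ; fixed-ok = λ x y i x∈S″ → fixed-ok x y i (proj₁ (∩⁻¹-⊆ S msg b x (S″⊆ x x∈S″)))
      ; run-ok = λ x y x∈S″ y∈T → let (x∈S , m≡b) = ∩⁻¹-⊆ S msg b x (S″⊆ x x∈S″) in
          trans (run-ok x y x∈S y∈T) (run-alice m Q₀ Q₁ b (ρA x) (ρB y) m≡b)
      ; thickS = thick″
      ; thickT = thickT
      ; budget = budget-branch c b Q₀ Q₁ budget
      ; density = density-after-messageˡ (N ^ p * M ^ p * 2 ^ (h * q)) c ((9 * p) ^ q)
                                         (size S) (size S″) (size T) density S≤3S″
      }) (continue-branch k₀ k₁ b)

  bobSpeaks : ∀ m Q₀ Q₁ → Continue Q₀ → Continue Q₁ → Continue (bob m Q₀ Q₁)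
  bobSpeaks m Q₀ Q₁ k₀ k₁ st inv (_ , spreadT) = speak (splitThick h free 1≤p T spreadT msg)
    where
    open State st
    open Invariant inv
    msg : CubeSet
    msg y = m (ρB y)
    speak : Σ Bool (λ b → Σ CubeSet λ T″ → T″ ⊆ (T ∩ msg ⁻¹ b) × Thick h free T″ × size T ≤ 3 * size T″) → Result st
    speak (b , T″ , T″⊆ , thick″ , T≤3T″) = repair (record st { T = T″ ; c = suc c }) (record
      { ρA-keeps = ρA-keeps
      ; ρB-keeps = ρB-keeps
      ; fixed-ok = λ x y i x∈S y∈T″ → fixed-ok x y i x∈S (proj₁ (∩⁻¹-⊆ T msg b y (T″⊆ y y∈T″)))
      ; run-ok = λ x y x∈S y∈T″ → let (y∈T , m≡b) = ∩⁻¹-⊆ T msg b y (T″⊆ y y∈T″) in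
          trans (run-ok x y x∈S y∈T) (run-bob m Q₀ Q₁ b (ρA x) (ρB y) m≡b)
      ; thickS = thickS
      ; thickT = thick″
      ; budget = budget-branch c b Q₀ Q₁ budget
      ; density = density-after-messageʳ (N ^ p * M ^ p * 2 ^ (h * q)) c ((9 * p) ^ q)
                                         (size S) (size T) (size T″) density T≤3T″
      }) (continue-branch k₀ k₁ b)

  simulate : ∀ P → Continue P
  simulate (output z) st inv _ = leaf z , leaf-correct z st inv , leaf-affordable st inv
  simulate (alice m Q₀ Q₁) = aliceSpeaks m Q₀ Q₁ (simulate Q₀) (simulate Q₁)
  simulate (bob m Q₀ Q₁) = bobSpeaks m Q₀ Q₁ (simulate Q₀) (simulate Q₁)

  initial : State
  initial = state (λ _ → true) (λ _ → false) (λ _ → true) (λ _ → true) id id 0 0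

  full-thick : ∀ {n} → Thick h (λ _ → true) (λ (_ : Vec (Fin n) p) → true)
  full-thick {n} j x _ _ = begin
    n                                   ≤⟨ m≤n*m n (2 ^ h) {{m^n≢0 2 h}} ⟩
    2 ^ h * n                           ≡⟨ cong (2 ^ h *_) (trans (∣fibre∣ j _ x) (trans (∑-const n 1) (*-identityʳ n))) ⟨
    2 ^ h * ∣ fibre j (λ _ → true) x ∣  ∎
    where open ≤-Reasoning

  initial-invariant : Invariant P₀ initial
  initial-invariant = record
    { ρA-keeps = λ _ _ _ → refl
    ; ρB-keeps = λ _ _ _ → refl
    ; fixed-ok = λ _ _ _ _ _ ()
    ; run-ok = λ _ _ _ _ → refl
    ; thickS = full-thick
    ; thickT = full-thick
    ; budget = ≤-refl
    ; density = ≤-reflexive (begin-equality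
        N ^ p * M ^ p * 2 ^ (h * 0)             ≡⟨ cong (λ e → N ^ p * M ^ p * 2 ^ e) (*-zeroʳ h) ⟩
        N ^ p * M ^ p * 1                       ≡⟨ *-identityʳ _ ⟩
        N ^ p * M ^ p                           ≡⟨ cong₂ _*_ (size-full {N} {p}) (size-full {M} {p}) ⟨
        size {N} {p} (λ _ → true) * size {M} {p} (λ _ → true)  ≡⟨ +-identityʳ _ ⟨
        1 * 1 * (size {N} {p} (λ _ → true) * size {M} {p} (λ _ → true)) ∎)
    }
    where open ≤-Reasoning

  simulation : Σ (DecTree p Z) λ T → TreeComputes T f × 2 ^ (h * depthT T) ≤ 3 ^ depthP P₀ * (9 * p) ^ depthT T
  simulation =
    let (T , correct , affordable) = repair initial initial-invariant (simulate P₀)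
    in T , (λ w → correct w λ _ ()) , subst Affordable (+-identityʳ (depthT T)) affordable

open import Data.Bool using (true; false)
open import Data.Nat.Properties using (<⇒≤)
open import Data.Product using (_,_)
open Arithmetic using (query-depth-bound)

theorem3 : (εn εd : ℕ) → 0 < εn → εn < εd →
    (δ : ℚ) → 0ℚ <ℚ δ → δ <ℚ (+ 1 /ℚ 6) →
    (h p : ℕ) → 6 * εd ≤ h * εn → 1 ≤ p → p ^ εd ≤ 2 ^ (h * (εd ∸ εn)) →
    (Z : Set) (f : Vec Bool p → Z) (na nb : ℕ) (g : PartialFun na nb) →
    HasHittingMonoDists g δ h →
    (P : Protocol (Vec (Fin na) p) (Vec (Fin nb) p) Z) →
    ProtocolComputes P (compose f g) →
    Σ (DecTree p Z) λ T → TreeComputes T f × depthT T * εn * h ≤ 4 * εd * depthP P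
theorem3 εn εd _ εn<εd δ _ δ<1/6 h p 6εd≤hεn 1≤p p^εd≤ Z f na nb g
         ((σ₀ , hitting₀ , mono₀) , (σ₁ , hitting₁ , mono₁)) P P-ok =
  conclude (Simulation.simulation g δ δ<1/6 h σ hitting mono 1≤p f P P-ok)
  where
  σ : Bool → RectDist na nb
  σ false = σ₀
  σ true = σ₁
  hitting : ∀ c → IsHitting δ h (σ c)
  hitting false = hitting₀
  hitting true = hitting₁
  mono : ∀ c → SupportedOn (Monochromatic g c) (σ c)
  mono false = mono₀
  mono true = mono₁
  conclude : Σ (DecTree p Z) (λ T → TreeComputes T f × 2 ^ (h * depthT T) ≤ 3 ^ depthP P * (9 * p) ^ depthT T) →
             Σ (DecTree p Z) λ T → TreeComputes T f × depthT T * εn * h ≤ 4 * εd * depthP P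
  conclude (T , computes , affordable) =
    T , computes , query-depth-bound εn εd h p (depthP P) (depthT T) (<⇒≤ εn<εd) 6εd≤hεn p^εd≤ affordable
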